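{- Let $d \geq 1$. Then for any integers $k,\ell \geq 0$ with $k+\ell \leq d-1$, there exist integral convex polytopes $\mathcal{P}, \mathcal{Q}\subset\mathbb{R}^d$ of dimension $d$ such that: (i) for $t=1,\ldots,k$, $i(\mathcal{P},t)=i(\mathcal{Q},t)$; (ii) for $t=1,\ldots,\ell$, $i^*(\mathcal{P},t)=i^*(\mathcal{Q},t)$; (iii) $i(\mathcal{P},k+1) \neq i(\mathcal{Q},k+1)$ and $i^*(\mathcal{P},\ell+1)\neq i^*(\mathcal{Q},\ell+1)$.
   Context: An integral convex polytope is a convex polytope all of whose vertices have integer coordinates. For an integral convex polytope $\mathcal{P}\subset\mathbb{R}^d$ with boundary $\partial\mathcal{P}$ and integer $n\ge1$, $i(\mathcal{P},n)=|n\mathcal{P}\cap\mathbb{Z}^d|$ and $i^*(\mathcal{P},n)=|n(\mathcal{P}\setminus\partial\mathcal{P})\cap\mathbb{Z}^d|$, where $n\mathcal{P}=\{n\alpha:\alpha\in\mathcal{P}\}$. -}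

module Defs where

open import Data.Nat as ℕ using (ℕ; zero; suc)
open import Data.Integer as ℤ using (ℤ)
open import Data.Rational as ℚ using (ℚ; 0ℚ; 1ℚ; _+_; _*_; _-_)
open import Data.Fin as Fin using (Fin; _≟_)
open import Data.Vec as Vec using (Vec)
open import Data.List as List using (List; length)
open import Data.List.Relation.Unary.Unique.Propositional using (Unique)
open import Data.List.Membership.Propositional using (_∈_)
open import Data.Product using (Σ; _×_; ∃; ∃-syntax)
open import Relation.Binary.PropositionalEquality using (_≡_; _≢_)
open import Relation.Nullary using (yes; no)

Point : ℕ → Set
Point d = Vec ℤ d

QPoint : ℕ → Set
QPoint d = Fin d → ℚ

toℚ : ℤ → ℚ
toℚ z = z ℚ./ 1

embed : ∀ {d} → Point d → QPoint d
embed x j = toℚ (Vec.lookup x j)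

∑ : (m : ℕ) → (Fin m → ℚ) → ℚ
∑ zero    f = 0ℚ
∑ (suc m) f = f Fin.zero + ∑ m (λ i → f (Fin.suc i))

-- An integral convex polytope is given as the convex hull conv(V) of a
-- finite list V of integer points (its vertices are then integral).
IntegralPolytope : ℕ → Set
IntegralPolytope d = List (Point d)

InDilate : ∀ {d} → IntegralPolytope d → ℕ → QPoint d → Set
InDilate {d} V n y =
  Σ (Fin (length V) → ℚ) λ c →
      (∀ i → 0ℚ ℚ.≤ c i)
    × (∑ (length V) c ≡ 1ℚ)
    × (∀ (j : Fin d) →
         ∑ (length V) (λ i → c i * (toℚ (ℤ.+ n) * toℚ (Vec.lookup (List.lookup V i) j))) ≡ y j)

shift : ∀ {d} → QPoint d → Fin d → ℚ → QPoint d
shift y j ε k with k ≟ j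
... | yes _ = y k + ε
... | no  _ = y k

-- y lies in the (topological) interior of n·conv(V): some cross-polytope
-- { y ± ε e_j } of positive (rational) radius ε lies in n·conv(V),
-- hence (by convexity) a ball around y does.
InInterior : ∀ {d} → IntegralPolytope d → ℕ → QPoint d → Set
InInterior {d} V n y =
  Σ ℚ λ ε → (0ℚ ℚ.< ε)
    × (∀ (j : Fin d) → InDilate V n (shift y j ε) × InDilate V n (shift y j (ℚ.- ε)))

-- conv(V) has dimension d (full-dimensional in ℝ^d) ⇔ nonempty interior
FullDim : ∀ {d} → IntegralPolytope d → Set
FullDim {d} V = Σ (QPoint d) λ y → InInterior V 1 y

HasCount : ∀ {d} → (Point d → Set) → ℕ → Set
HasCount {d} S c =
  Σ (List (Point d)) λ xs → (length xs ≡ c) × Unique xs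
    × (∀ x → (S x → x ∈ xs) × (x ∈ xs → S x))

LatticePts : ∀ {d} → IntegralPolytope d → ℕ → Point d → Set
LatticePts V n x = InDilate V n (embed x)

InteriorLatticePts : ∀ {d} → IntegralPolytope d → ℕ → Point d → Set
InteriorLatticePts V n x = InInterior V n (embed x)

SameCount : ∀ {d} → (Point d → Set) → (Point d → Set) → Set
SameCount S T = ∃[ c ] (HasCount S c × HasCount T c)

DiffCount : ∀ {d} → (Point d → Set) → (Point d → Set) → Set
DiffCount S T = ∃[ c ] ∃[ c' ] (HasCount S c × HasCount T c' × c ≢ c')

-- In dimension d = n + 1 consider the simplex S(a, e) with vertices 0, e₁, …, eₙ and (m, w), where
-- m = e + a + 1, e ≤ 1 and w = (−1, …, −1, 0, …, 0) has a entries −1. Multiplied by m, its barycentric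
-- coordinates become integral affine functions, so the lattice points x of t · S(a, e) are exactly the
-- points with x₀ = q m + r (0 ≤ r < m) and xⱼ = yⱼ + q wⱼ, where y ≥ 0 and Σ y + q + r ≤ t. For t < m the
-- condition r < m is automatic, so i(S(a, e), t) does not depend on (a, e); at t = m any S(a′, e′) with larger m
-- has exactly one more lattice point, the one with (q, r, y) = (0, m, 0). At an interior lattice point the
-- scaled barycentric coordinates are positive integers, at least 1 and, where wⱼ = 0, at least m; as they sum
-- to m t there is none while m t < m (n − a) + a + 2, and exactly one, (1, 1 + w), when equality holds.
-- Hence P = S(n − ℓ, 1) and Q = S(k, 0) agree on i for t ≤ k, on i* for t ≤ ℓ, and differ at k + 1 and ℓ + 1.

module Submission where

open import Defs
open import Data.Nat as ℕ using (ℕ; zero; suc; _∸_)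
import Data.Nat.Properties as ℕP
import Data.Nat.DivMod as DivMod
import Data.Nat.Tactic.RingSolver as ℕSolver
import Data.Nat.Coprimality as Coprimality
open import Data.Integer as ℤ using (ℤ; +_; -[1+_]; +[1+_])
import Data.Integer.Properties as ℤP
import Data.Integer.Tactic.RingSolver as ℤSolver
open import Data.Rational as ℚ using (ℚ; mkℚ; 0ℚ; 1ℚ)
import Data.Rational.Properties as ℚP
open import Data.Rational.Solver using (module +-*-Solver)
open import Data.Fin as Fin using (Fin; zero; suc; _≟_)
import Data.Fin.Properties as FinP
open import Data.Fin.Permutation using (Permutation; _⟨$⟩ʳ_; _⟨$⟩ˡ_; inverseˡ; cast-id)
open import Data.Vec as Vec using (Vec; _∷_; [])
import Data.Vec.Properties as VecP
open import Data.List as List using (List; length)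
open import Data.List.Membership.Propositional using (_∈_)
open import Data.List.Membership.Propositional.Properties using (∈-map⁺; ∈-map⁻; ∈-++⁺ˡ; ∈-++⁺ʳ; ∈-upTo⁺; ∈-filter⁺; ∈-filter⁻; ∈-cartesianProductWith⁺)
open import Data.List.Relation.Unary.Any using (here; there)
import Data.List.Relation.Unary.All as All
import Data.List.Relation.Unary.All.Properties as AllP
import Data.List.Relation.Unary.AllPairs as AllPairs
open import Data.List.Relation.Unary.Unique.Propositional using (Unique)
import Data.List.Relation.Unary.Unique.Propositional.Properties as UniqueP
open import Relation.Unary using (Decidable)
import Data.List.Properties as ListP
import Algebra.Properties.Semiring.Sum as SemiringSum
open import Algebra.Bundles using (Ring)
open import Data.Product using (Σ; _×_; _,_; proj₁; proj₂; map₂)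
open import Data.Sum using (_⊎_; inj₁; inj₂; [_,_]′)
open import Function using (id)
open import Data.Empty using (⊥)
open import Relation.Nullary using (yes; no; ¬_; contradiction)
open import Relation.Binary.PropositionalEquality
open ≡-Reasoning

private
  ι : ℤ → ℚ
  ι z = mkℚ z 0 (Coprimality.sym (Coprimality.1-coprimeTo _))

  toℚ≡ι : ∀ z → toℚ z ≡ ι z
  toℚ≡ι (+ n)    = ℚP.normalize-coprime (Coprimality.sym (Coprimality.1-coprimeTo n))
  toℚ≡ι -[1+ n ] = cong ℚ.-_ (ℚP.normalize-coprime (Coprimality.sym (Coprimality.1-coprimeTo (suc n))))

toℚ-homo-+ : ∀ a b → toℚ (a ℤ.+ b) ≡ toℚ a ℚ.+ toℚ b
toℚ-homo-+ a b = begin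
  toℚ (a ℤ.+ b)                  ≡⟨ cong₂ (λ x y → toℚ (x ℤ.+ y)) (ℤP.*-identityʳ a) (ℤP.*-identityʳ b) ⟨
  toℚ (a ℤ.* + 1 ℤ.+ b ℤ.* + 1)  ≡⟨⟩
  ι a ℚ.+ ι b                    ≡⟨ cong₂ ℚ._+_ (toℚ≡ι a) (toℚ≡ι b) ⟨
  toℚ a ℚ.+ toℚ b                ∎

toℚ-homo-* : ∀ a b → toℚ (a ℤ.* b) ≡ toℚ a ℚ.* toℚ b
toℚ-homo-* a b = sym (cong₂ ℚ._*_ (toℚ≡ι a) (toℚ≡ι b))

toℚ-homo‿- : ∀ a → toℚ (ℤ.- a) ≡ ℚ.- toℚ a
toℚ-homo‿- a = trans (toℚ≡ι (ℤ.- a)) (trans (ι-neg a) (cong ℚ.-_ (sym (toℚ≡ι a))))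
  where
  ι-neg : ∀ a → ι (ℤ.- a) ≡ ℚ.- ι a
  ι-neg (+ zero)  = refl
  ι-neg +[1+ n ]  = refl
  ι-neg -[1+ n ]  = refl

toℚ-homo-- : ∀ a b → toℚ (a ℤ.- b) ≡ toℚ a ℚ.- toℚ b
toℚ-homo-- a b = trans (toℚ-homo-+ a (ℤ.- b)) (cong (λ u → toℚ a ℚ.+ u) (toℚ-homo‿- b))

toℚ-mono-≤ : ∀ {a b} → a ℤ.≤ b → toℚ a ℚ.≤ toℚ b
toℚ-mono-≤ {a} {b} a≤b = subst₂ ℚ._≤_ (sym (toℚ≡ι a)) (sym (toℚ≡ι b))
  (ℚ.*≤* (subst₂ ℤ._≤_ (sym (ℤP.*-identityʳ a)) (sym (ℤP.*-identityʳ b)) a≤b))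

toℚ-cancel-≤ : ∀ {a b} → toℚ a ℚ.≤ toℚ b → a ℤ.≤ b
toℚ-cancel-≤ {a} {b} p = subst₂ ℤ._≤_ (ℤP.*-identityʳ a) (ℤP.*-identityʳ b) (ℚP.drop-*≤* (subst₂ ℚ._≤_ (toℚ≡ι a) (toℚ≡ι b) p))

toℚ-cancel-< : ∀ {a b} → toℚ a ℚ.< toℚ b → a ℤ.< b
toℚ-cancel-< {a} {b} p = subst₂ ℤ._<_ (ℤP.*-identityʳ a) (ℤP.*-identityʳ b) (ℚP.drop-*<* (subst₂ ℚ._<_ (toℚ≡ι a) (toℚ≡ι b) p))

1/suc : ℕ → ℚ
1/suc k = ℚ.1/ ι (+ suc k)

*-1/suc : ∀ k → toℚ (+ suc k) ℚ.* 1/suc k ≡ 1ℚ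
*-1/suc k = trans (cong (ℚ._* 1/suc k) (toℚ≡ι (+ suc k))) (ℚP.*-inverseʳ (ι (+ suc k)))

1/suc-pos : ∀ k → 0ℚ ℚ.< 1/suc k
1/suc-pos k = ℚ.*<* (ℤ.+<+ (ℕ.s≤s ℕ.z≤n))

toℚ-nonneg : ∀ k → 0ℚ ℚ.≤ toℚ (+ k)
toℚ-nonneg k = toℚ-mono-≤ {+ 0} {+ k} (ℤ.+≤+ ℕ.z≤n)

0≤* : ∀ {a b} → 0ℚ ℚ.≤ a → 0ℚ ℚ.≤ b → 0ℚ ℚ.≤ a ℚ.* b
0≤* {a} {b} a≥0 b≥0 = ℚP.nonNegative⁻¹ _ {{ℚP.nonNeg*nonNeg⇒nonNeg a {{ℚ.nonNegative a≥0}} b {{ℚ.nonNegative b≥0}}}}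

module ℚΣ = SemiringSum (Ring.semiring ℚP.+-*-ring)
module ℤΣ = SemiringSum ℤP.+-*-semiring

∑≡sum : ∀ n (f : Fin n → ℚ) → ∑ n f ≡ ℚΣ.sum f
∑≡sum zero    f = refl
∑≡sum (suc n) f = cong (λ s → f zero ℚ.+ s) (∑≡sum n (λ i → f (suc i)))

∑-cong : ∀ n {f g : Fin n → ℚ} → (∀ i → f i ≡ g i) → ∑ n f ≡ ∑ n g
∑-cong zero    f≗g = refl
∑-cong (suc n) f≗g = cong₂ ℚ._+_ (f≗g zero) (∑-cong n (λ i → f≗g (suc i)))

∑-distrib-+ : ∀ n (f g : Fin n → ℚ) → ∑ n (λ i → f i ℚ.+ g i) ≡ ∑ n f ℚ.+ ∑ n g
∑-distrib-+ n f g = begin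
  ∑ n (λ i → f i ℚ.+ g i)     ≡⟨ ∑≡sum n _ ⟩
  ℚΣ.sum (λ i → f i ℚ.+ g i)  ≡⟨ ℚΣ.∑-distrib-+ f g ⟩
  ℚΣ.sum f ℚ.+ ℚΣ.sum g       ≡⟨ cong₂ ℚ._+_ (∑≡sum n f) (∑≡sum n g) ⟨
  ∑ n f ℚ.+ ∑ n g             ∎

*-distribˡ-∑ : ∀ n a (f : Fin n → ℚ) → a ℚ.* ∑ n f ≡ ∑ n (λ i → a ℚ.* f i)
*-distribˡ-∑ n a f = begin
  a ℚ.* ∑ n f               ≡⟨ cong (a ℚ.*_) (∑≡sum n f) ⟩
  a ℚ.* ℚΣ.sum f            ≡⟨ ℚΣ.*-distribˡ-sum a f ⟩
  ℚΣ.sum (λ i → a ℚ.* f i)  ≡⟨ ∑≡sum n _ ⟨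
  ∑ n (λ i → a ℚ.* f i)     ∎

*-distribʳ-∑ : ∀ n a (f : Fin n → ℚ) → ∑ n f ℚ.* a ≡ ∑ n (λ i → f i ℚ.* a)
*-distribʳ-∑ n a f = begin
  ∑ n f ℚ.* a               ≡⟨ cong (ℚ._* a) (∑≡sum n f) ⟩
  ℚΣ.sum f ℚ.* a            ≡⟨ ℚΣ.*-distribʳ-sum a f ⟩
  ℚΣ.sum (λ i → f i ℚ.* a)  ≡⟨ ∑≡sum n _ ⟨
  ∑ n (λ i → f i ℚ.* a)     ∎

∑-zero : ∀ n → ∑ n (λ _ → 0ℚ) ≡ 0ℚ
∑-zero n = trans (∑≡sum n _) (ℚΣ.sum-replicate-zero n)

∑-permute : ∀ {k k′} (f : Fin k′ → ℚ) (π : Permutation k k′) → ∑ k′ f ≡ ∑ k (λ i → f (π ⟨$⟩ʳ i))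
∑-permute {k} {k′} f π = begin
  ∑ k′ f                       ≡⟨ ∑≡sum k′ f ⟩
  ℚΣ.sum f                     ≡⟨ ℚΣ.∑-permute f π ⟩
  ℚΣ.sum (λ i → f (π ⟨$⟩ʳ i))  ≡⟨ ∑≡sum k _ ⟨
  ∑ k (λ i → f (π ⟨$⟩ʳ i))     ∎

toℚ-homo-sum : ∀ n (f : Fin n → ℤ) → toℚ (ℤΣ.sum f) ≡ ∑ n (λ i → toℚ (f i))
toℚ-homo-sum zero    f = refl
toℚ-homo-sum (suc n) f = trans (toℚ-homo-+ (f zero) _) (cong (λ s → toℚ (f zero) ℚ.+ s) (toℚ-homo-sum n (λ i → f (suc i))))

0≤*ℤ : ∀ {a b} → + 0 ℤ.≤ a → + 0 ℤ.≤ b → + 0 ℤ.≤ a ℤ.* b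
0≤*ℤ {+ k} {+ l} _ _ = subst (+ 0 ℤ.≤_) (ℤP.pos-* k l) (ℤ.+≤+ ℕ.z≤n)

sumℤ-mono : ∀ n {f g : Fin n → ℤ} → (∀ i → f i ℤ.≤ g i) → ℤΣ.sum f ℤ.≤ ℤΣ.sum g
sumℤ-mono zero    f≤g = ℤP.≤-refl
sumℤ-mono (suc n) f≤g = ℤP.+-mono-≤ (f≤g zero) (sumℤ-mono n (λ i → f≤g (suc i)))

sumℤ-const : ∀ n c → ℤΣ.sum {n} (λ _ → c) ≡ + n ℤ.* c
sumℤ-const zero    c = sym (ℤP.*-zeroˡ c)
sumℤ-const (suc n) c = begin
  c ℤ.+ ℤΣ.sum {n} (λ _ → c)  ≡⟨ cong (λ s → c ℤ.+ s) (sumℤ-const n c) ⟩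
  c ℤ.+ + n ℤ.* c             ≡⟨ factor c (+ n) ⟩
  (+ 1 ℤ.+ + n) ℤ.* c         ≡⟨ cong (ℤ._* c) (ℤP.pos-+ 1 n) ⟨
  + suc n ℤ.* c               ∎
  where
  factor : ∀ c k → c ℤ.+ k ℤ.* c ≡ (+ 1 ℤ.+ k) ℤ.* c
  factor = ℤSolver.solve-∀

sumℤ-linear : ∀ n (f g : Fin n → ℤ) c d → ℤΣ.sum (λ j → c ℤ.* f j ℤ.- g j ℤ.* d) ≡ c ℤ.* ℤΣ.sum f ℤ.- ℤΣ.sum g ℤ.* d
sumℤ-linear zero    f g c d = empty c d
  where
  empty : ∀ c d → + 0 ≡ c ℤ.* + 0 ℤ.- + 0 ℤ.* d
  empty = ℤSolver.solve-∀
sumℤ-linear (suc n) f g c d =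
  trans (cong (λ s → c ℤ.* f zero ℤ.- g zero ℤ.* d ℤ.+ s) (sumℤ-linear n (λ j → f (suc j)) (λ j → g (suc j)) c d))
        (regroup c d (f zero) (g zero) (ℤΣ.sum (λ j → f (suc j))) (ℤΣ.sum (λ j → g (suc j))))
  where
  regroup : ∀ c d f₀ g₀ F G → c ℤ.* f₀ ℤ.- g₀ ℤ.* d ℤ.+ (c ℤ.* F ℤ.- G ℤ.* d) ≡ c ℤ.* (f₀ ℤ.+ F) ℤ.- (g₀ ℤ.+ G) ℤ.* d
  regroup = ℤSolver.solve-∀

sumℤ-nonneg : ∀ n {f : Fin n → ℤ} → (∀ i → + 0 ℤ.≤ f i) → + 0 ℤ.≤ ℤΣ.sum f
sumℤ-nonneg n {f} f≥0 = subst (ℤ._≤ ℤΣ.sum f) (ℤΣ.sum-replicate-zero n) (sumℤ-mono n f≥0)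

sumℤ-term : ∀ n {f : Fin n → ℤ} → (∀ i → + 0 ℤ.≤ f i) → ∀ j → f j ℤ.≤ ℤΣ.sum f
sumℤ-term (suc n) {f} f≥0 zero    =
  subst (ℤ._≤ ℤΣ.sum f) (ℤP.+-identityʳ (f zero)) (ℤP.+-monoʳ-≤ (f zero) (sumℤ-nonneg n (λ i → f≥0 (suc i))))
sumℤ-term (suc n) {f} f≥0 (suc j) =
  ℤP.≤-trans (sumℤ-term n (λ i → f≥0 (suc i)) j)
             (subst (ℤ._≤ ℤΣ.sum f) (ℤP.+-identityˡ _) (ℤP.+-monoˡ-≤ (ℤΣ.sum (λ i → f (suc i))) (f≥0 zero)))

+-cancelˡ-≤ : ∀ a {b c} → a ℤ.+ b ℤ.≤ a ℤ.+ c → b ℤ.≤ c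
+-cancelˡ-≤ a {b} {c} a+b≤a+c = subst₂ ℤ._≤_ (cancel a b) (cancel a c) (ℤP.+-monoʳ-≤ (ℤ.- a) a+b≤a+c)
  where
  cancel : ∀ a b → ℤ.- a ℤ.+ (a ℤ.+ b) ≡ b
  cancel = ℤSolver.solve-∀

sumℤ-tight : ∀ n {f g : Fin n → ℤ} → (∀ i → f i ℤ.≤ g i) → ℤΣ.sum g ℤ.≤ ℤΣ.sum f → ∀ i → f i ≡ g i
sumℤ-tight (suc n) {f} {g} f≤g ∑g≤∑f zero = ℤP.≤-antisym (f≤g zero) (+-cancelʳ-≤ (ℤP.≤-trans ∑g≤∑f (ℤP.+-monoʳ-≤ (f zero) ∑f′≤∑g′)))
  where
  ∑f′≤∑g′ = sumℤ-mono n (λ i → f≤g (suc i))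
  +-cancelʳ-≤ : ∀ {a b c} → a ℤ.+ c ℤ.≤ b ℤ.+ c → a ℤ.≤ b
  +-cancelʳ-≤ {a} {b} {c} h = +-cancelˡ-≤ c (subst₂ ℤ._≤_ (ℤP.+-comm a c) (ℤP.+-comm b c) h)
sumℤ-tight (suc n) {f} {g} f≤g ∑g≤∑f (suc i) = sumℤ-tight n (λ i → f≤g (suc i)) tail-tight i
  where
  tail-tight = +-cancelˡ-≤ (g zero) (ℤP.≤-trans ∑g≤∑f (ℤP.+-monoˡ-≤ (ℤΣ.sum (λ i → f (suc i))) (f≤g zero)))

nonneg-of-remainder : ∀ m z r → + 0 ℤ.≤ + m ℤ.* z ℤ.+ + r → r ℕ.< m → + 0 ℤ.≤ z
nonneg-of-remainder m (+ k)    r _      _   = ℤ.+≤+ ℕ.z≤n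
nonneg-of-remainder m -[1+ k ] r 0≤mz+r r<m = contradiction 0≤mz+r (ℤP.<⇒≱ mz+r<0)
  where
  times-minus-one : ∀ a → a ℤ.* -[1+ 0 ] ≡ ℤ.- a
  times-minus-one = ℤSolver.solve-∀
  mz≤-m : + m ℤ.* -[1+ k ] ℤ.≤ ℤ.- + m
  mz≤-m = subst (+ m ℤ.* -[1+ k ] ℤ.≤_) (times-minus-one (+ m)) (ℤP.*-monoˡ-≤-nonNeg (+ m) (ℤ.-≤- ℕ.z≤n))
  mz+r<0 : + m ℤ.* -[1+ k ] ℤ.+ + r ℤ.< + 0
  mz+r<0 = ℤP.≤-<-trans (ℤP.+-monoˡ-≤ (+ r) mz≤-m)
                        (subst (ℤ.- + m ℤ.+ + r ℤ.<_) (ℤP.+-inverseˡ (+ m)) (ℤP.+-monoʳ-< (ℤ.- + m) (ℤ.+<+ r<m)))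

δ : ∀ {n} → Fin n → Fin n → ℤ
δ zero    zero    = + 1
δ zero    (suc j) = + 0
δ (suc i) zero    = + 0
δ (suc i) (suc j) = δ i j

δ-refl : ∀ {n} (k : Fin n) → δ k k ≡ + 1
δ-refl zero    = refl
δ-refl (suc k) = δ-refl k

δ-01 : ∀ {n} (k j : Fin n) → δ k j ≡ + 0 ⊎ δ k j ≡ + 1
δ-01 zero    zero    = inj₂ refl
δ-01 zero    (suc j) = inj₁ refl
δ-01 (suc k) zero    = inj₁ refl
δ-01 (suc k) (suc j) = δ-01 k j

∑-δ : ∀ n (f : Fin n → ℚ) j → ∑ n (λ k → f k ℚ.* toℚ (δ k j)) ≡ f j
∑-δ (suc n) f zero = begin
  f zero ℚ.* 1ℚ ℚ.+ ∑ n (λ k → f (suc k) ℚ.* 0ℚ)  ≡⟨ cong₂ ℚ._+_ (ℚP.*-identityʳ (f zero)) (∑-cong n (λ k → ℚP.*-zeroʳ (f (suc k)))) ⟩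
  f zero ℚ.+ ∑ n (λ _ → 0ℚ)                       ≡⟨ cong (λ s → f zero ℚ.+ s) (∑-zero n) ⟩
  f zero ℚ.+ 0ℚ                                   ≡⟨ ℚP.+-identityʳ (f zero) ⟩
  f zero                                          ∎
∑-δ (suc n) f (suc j) = begin
  f zero ℚ.* 0ℚ ℚ.+ ∑ n (λ k → f (suc k) ℚ.* toℚ (δ k j))  ≡⟨ cong₂ ℚ._+_ (ℚP.*-zeroʳ (f zero)) (∑-δ n (λ k → f (suc k)) j) ⟩
  0ℚ ℚ.+ f (suc j)                                         ≡⟨ ℚP.+-identityˡ (f (suc j)) ⟩
  f (suc j)                                                ∎

InDilateᶠ : ∀ {d k} → (Fin k → Point d) → ℕ → QPoint d → Set
InDilateᶠ {d} {k} v T y =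
  Σ (Fin k → ℚ) λ c →
      (∀ i → 0ℚ ℚ.≤ c i)
    × (∑ k c ≡ 1ℚ)
    × (∀ (j : Fin d) → ∑ k (λ i → c i ℚ.* (toℚ (+ T) ℚ.* toℚ (Vec.lookup (v i) j))) ≡ y j)

InDilateᶠ-permute : ∀ {d k k′ T y} {u : Fin k → Point d} {v : Fin k′ → Point d} (π : Permutation k k′) →
                    (∀ i → v (π ⟨$⟩ʳ i) ≡ u i) → InDilateᶠ v T y → InDilateᶠ u T y
InDilateᶠ-permute {k = k} {k′} {T} {u = u} {v} π v∘π≗u (c , c≥0 , ∑c≡1 , c-comb) =
  (λ i → c (π ⟨$⟩ʳ i)) , (λ i → c≥0 _) , trans (sym (∑-permute c π)) ∑c≡1 , λ j → trans (reindex j) (c-comb j)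
  where
  reindex : ∀ j → ∑ k (λ i → c (π ⟨$⟩ʳ i) ℚ.* (toℚ (+ T) ℚ.* toℚ (Vec.lookup (u i) j)))
                ≡ ∑ k′ (λ i → c i ℚ.* (toℚ (+ T) ℚ.* toℚ (Vec.lookup (v i) j)))
  reindex j = trans (∑-cong k (λ i → cong (λ p → c (π ⟨$⟩ʳ i) ℚ.* (toℚ (+ T) ℚ.* toℚ (Vec.lookup p j))) (sym (v∘π≗u i))))
                    (sym (∑-permute _ π))

InDilate-tabulate⁻ : ∀ {d k T y} (v : Fin k → Point d) → InDilate (List.tabulate v) T y → InDilateᶠ v T y
InDilate-tabulate⁻ {T = T} {y} v =
  InDilateᶠ-permute {T = T} {y} {u = v} {v = List.lookup (List.tabulate v)} (cast-id (sym (ListP.length-tabulate v))) (ListP.lookup-tabulate v)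

InDilate-tabulate⁺ : ∀ {d k T y} (v : Fin k → Point d) → InDilateᶠ v T y → InDilate (List.tabulate v) T y
InDilate-tabulate⁺ {T = T} {y} v = InDilateᶠ-permute {T = T} {y} {v = v} π lookup-π
  where
  π = cast-id (ListP.length-tabulate v)
  lookup-π : ∀ i → v (π ⟨$⟩ʳ i) ≡ List.lookup (List.tabulate v) i
  lookup-π i = trans (sym (ListP.lookup-tabulate v (π ⟨$⟩ʳ i))) (cong (List.lookup (List.tabulate v)) (inverseˡ π))

lookup-ext : ∀ {d} {x x′ : Point d} → (∀ j → Vec.lookup x j ≡ Vec.lookup x′ j) → x ≡ x′
lookup-ext {x = x} {x′} x≗x′ = trans (sym (VecP.tabulate∘lookup x)) (trans (VecP.tabulate-cong x≗x′) (VecP.tabulate∘lookup x′))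

shift-δ : ∀ {d} (y : QPoint d) j s k → shift y j s k ≡ y k ℚ.+ s ℚ.* toℚ (δ k j)
shift-δ y j s k with k ≟ j
... | yes refl = sym (trans (cong (λ z → y k ℚ.+ s ℚ.* toℚ z) (δ-refl k)) (cong (λ z → y k ℚ.+ z) (ℚP.*-identityʳ s)))
... | no k≢j = sym (trans (cong (λ z → y k ℚ.+ s ℚ.* toℚ z) (δ-≢ k j k≢j)) (trans (cong (λ z → y k ℚ.+ z) (ℚP.*-zeroʳ s)) (ℚP.+-identityʳ (y k))))
  where
  δ-≢ : ∀ {n} (k j : Fin n) → k ≢ j → δ k j ≡ + 0
  δ-≢ zero    zero    k≢j = contradiction refl k≢j
  δ-≢ zero    (suc j) k≢j = refl
  δ-≢ (suc k) zero    k≢j = refl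
  δ-≢ (suc k) (suc j) k≢j = δ-≢ k j (λ k≡j → k≢j (cong suc k≡j))

InDilate-cong : ∀ {d} (V : IntegralPolytope d) T {y y′ : QPoint d} → (∀ j → y j ≡ y′ j) → InDilate V T y → InDilate V T y′
InDilate-cong V T y≗y′ (c , c≥0 , ∑c≡1 , c-comb) = c , c≥0 , ∑c≡1 , λ j → trans (c-comb j) (y≗y′ j)

InDilate-shrink : ∀ {d} (V : IntegralPolytope d) T y → InDilate V (suc T) y → InDilate V 1 (λ j → y j ℚ.* 1/suc T)
InDilate-shrink V T y (c , c≥0 , ∑c≡1 , c-comb) = c , c≥0 , ∑c≡1 , λ j → begin
  ∑ (length V) (λ i → c i ℚ.* (1ℚ ℚ.* v i j))       ≡⟨ ∑-cong (length V) (λ i → rescale (c i) (v i j)) ⟩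
  ∑ (length V) (λ i → c i ℚ.* (t ℚ.* v i j) ℚ.* r)  ≡⟨ *-distribʳ-∑ (length V) r _ ⟨
  ∑ (length V) (λ i → c i ℚ.* (t ℚ.* v i j)) ℚ.* r  ≡⟨ cong (ℚ._* r) (c-comb j) ⟩
  y j ℚ.* r                                         ∎
  where
  open +-*-Solver
  t = toℚ (+ suc T)
  r = 1/suc T
  v : Fin (length V) → Fin _ → ℚ
  v i j = toℚ (Vec.lookup (List.lookup V i) j)
  rescale : ∀ a b → a ℚ.* (1ℚ ℚ.* b) ≡ a ℚ.* (t ℚ.* b) ℚ.* r
  rescale a b = begin
    a ℚ.* (1ℚ ℚ.* b)         ≡⟨ solve 2 (λ a b → a :* (con 1ℚ :* b) := (a :* b) :* con 1ℚ) refl a b ⟩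
    (a ℚ.* b) ℚ.* 1ℚ         ≡⟨ cong ((a ℚ.* b) ℚ.*_) (*-1/suc T) ⟨
    (a ℚ.* b) ℚ.* (t ℚ.* r)  ≡⟨ solve 4 (λ a b t r → (a :* b) :* (t :* r) := a :* (t :* b) :* r) refl a b t r ⟩
    a ℚ.* (t ℚ.* b) ℚ.* r    ∎

InInterior-shrink : ∀ {d} (V : IntegralPolytope d) T y → InInterior V (suc T) y → InInterior V 1 (λ j → y j ℚ.* 1/suc T)
InInterior-shrink V T y (ε , ε>0 , inside) =
  ε ℚ.* r , ℚP.positive⁻¹ _ {{ℚP.pos*pos⇒pos ε {{ℚ.positive ε>0}} r {{ℚ.positive (1/suc-pos T)}}}} , λ j →
    InDilate-cong V 1 (rescaled-shift j ε) (InDilate-shrink V T _ (proj₁ (inside j))) ,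
    InDilate-cong V 1 (λ k → trans (rescaled-shift j (ℚ.- ε) k) (cong (λ s → shift _ j s k) (sym (ℚP.neg-distribˡ-* ε r))))
                      (InDilate-shrink V T _ (proj₂ (inside j)))
  where
  open +-*-Solver
  r = 1/suc T
  rescaled-shift : ∀ j s k → shift y j s k ℚ.* r ≡ shift (λ j → y j ℚ.* r) j (s ℚ.* r) k
  rescaled-shift j s k = begin
    shift y j s k ℚ.* r                      ≡⟨ cong (ℚ._* r) (shift-δ y j s k) ⟩
    (y k ℚ.+ s ℚ.* toℚ (δ k j)) ℚ.* r        ≡⟨ solve 4 (λ y s e r → (y :+ s :* e) :* r := y :* r :+ (s :* r) :* e) refl (y k) s (toℚ (δ k j)) r ⟩
    y k ℚ.* r ℚ.+ (s ℚ.* r) ℚ.* toℚ (δ k j)  ≡⟨ shift-δ (λ j → y j ℚ.* r) j (s ℚ.* r) k ⟨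
    shift (λ j → y j ℚ.* r) j (s ℚ.* r) k    ∎

-- Counting lattice points

HasCount-cong : ∀ {d} {S S′ : Point d → Set} {c} → (∀ x → S x → S′ x) → (∀ x → S′ x → S x) → HasCount S c → HasCount S′ c
HasCount-cong S⊆S′ S′⊆S (xs , len , unique , complete) =
  xs , len , unique , λ x → (λ x∈S′ → proj₁ (complete x) (S′⊆S x x∈S′)) , (λ x∈xs → S⊆S′ x (proj₂ (complete x) x∈xs))

HasCount-∅ : ∀ {d} {S : Point d → Set} → (∀ x → ¬ S x) → HasCount S 0
HasCount-∅ S-empty = List.[] , refl , AllPairs.[] , λ x → (λ x∈S → contradiction x∈S (S-empty x)) , λ ()

HasCount-insert : ∀ {d} {S : Point d → Set} {c} z → ¬ S z → HasCount S c → HasCount (λ x → x ≡ z ⊎ S x) (suc c)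
HasCount-insert z z∉S (xs , len , unique , complete) =
    z List.∷ xs , cong suc len , All.tabulate (λ x∈xs z≡x → z∉S (subst _ (sym z≡x) (proj₂ (complete _) x∈xs))) AllPairs.∷ unique
  , λ x → (λ { (inj₁ refl) → here refl ; (inj₂ x∈S) → there (proj₁ (complete x) x∈S) })
        , (λ { (here refl) → inj₁ refl ; (there x∈xs) → inj₂ (proj₂ (complete x) x∈xs) })

HasCount-singleton : ∀ {d} {S : Point d → Set} z → S z → (∀ x → S x → x ≡ z) → HasCount S 1
HasCount-singleton z z∈S S⊆z =
  HasCount-cong (λ { x (inj₁ refl) → z∈S ; x (inj₂ ()) }) (λ x x∈S → inj₁ (S⊆z x x∈S))
                (HasCount-insert {S = λ _ → ⊥} z (λ ()) (HasCount-∅ (λ x ())))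

Image : ∀ {d} → (Point d → Point d) → (Point d → Set) → Point d → Set
Image f S y = Σ (Point _) λ x → S x × f x ≡ y

HasCount-image : ∀ {d} {S : Point d → Set} {c} (f : Point d → Point d) →
                 (∀ x x′ → S x → S x′ → f x ≡ f x′ → x ≡ x′) → HasCount S c → HasCount (Image f S) c
HasCount-image {S = S} f f-injective (xs , len , unique , complete) =
  List.map f xs , trans (ListP.length-map f xs) len , map-unique xs (λ x∈xs → proj₂ (complete _) x∈xs) unique , λ y →
    (λ { (x , x∈S , refl) → ∈-map⁺ f (proj₁ (complete x) x∈S) })
  , (λ y∈fxs → let (x , x∈xs , y≡fx) = ∈-map⁻ f y∈fxs in x , proj₂ (complete x) x∈xs , sym y≡fx)
  where
  map-unique : ∀ xs → (∀ {x} → x ∈ xs → S x) → Unique xs → Unique (List.map f xs)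
  map-unique List.[]       xs⊆S AllPairs.[]          = AllPairs.[]
  map-unique (x List.∷ xs) xs⊆S (x∉xs AllPairs.∷ unique) =
      AllP.map⁺ (All.tabulate (λ x′∈xs fx≡fx′ → All.lookup x∉xs x′∈xs (f-injective _ _ (xs⊆S (here refl)) (xs⊆S (there x′∈xs)) fx≡fx′)))
      AllPairs.∷ map-unique xs (λ x′∈xs → xs⊆S (there x′∈xs)) unique

private
  integersWithin : ℕ → List ℤ
  integersWithin B = List.map +_ (List.upTo (suc B)) List.++ List.map -[1+_] (List.upTo B)

  integersWithin-unique : ∀ B → Unique (integersWithin B)
  integersWithin-unique B = UniqueP.++⁺ (UniqueP.map⁺ ℤP.+-injective (UniqueP.upTo⁺ (suc B))) (UniqueP.map⁺ ℤP.-[1+-injective (UniqueP.upTo⁺ B)) disjoint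
    where
    disjoint : ∀ {z} → ¬ (z ∈ List.map +_ (List.upTo (suc B)) × z ∈ List.map -[1+_] (List.upTo B))
    disjoint (z∈₁ , z∈₂) with ∈-map⁻ +_ z∈₁ | ∈-map⁻ -[1+_] z∈₂
    ... | _ , _ , refl | _ , _ , ()

  integersWithin-complete : ∀ B z → ℤ.∣ z ∣ ℕ.≤ B → z ∈ integersWithin B
  integersWithin-complete B (+ i)    ∣z∣≤B = ∈-++⁺ˡ (∈-map⁺ +_ (∈-upTo⁺ (ℕ.s≤s ∣z∣≤B)))
  integersWithin-complete B -[1+ i ] ∣z∣≤B = ∈-++⁺ʳ (List.map +_ (List.upTo (suc B))) (∈-map⁺ -[1+_] (∈-upTo⁺ ∣z∣≤B))

  vectors : ∀ d → List ℤ → List (Point d)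
  vectors zero    R = [] List.∷ List.[]
  vectors (suc d) R = List.cartesianProductWith _∷_ R (vectors d R)

  vectors-unique : ∀ d R → Unique R → Unique (vectors d R)
  vectors-unique zero    R unique = All.[] AllPairs.∷ AllPairs.[]
  vectors-unique (suc d) R unique = UniqueP.cartesianProductWith⁺ _∷_ VecP.∷-injective unique (vectors-unique d R unique)

  vectors-complete : ∀ d R (x : Point d) → (∀ j → Vec.lookup x j ∈ R) → x ∈ vectors d R
  vectors-complete zero    R []       x⊆R = here refl
  vectors-complete (suc d) R (x ∷ xs) x⊆R = ∈-cartesianProductWith⁺ _∷_ (x⊆R zero) (vectors-complete d R xs (λ j → x⊆R (suc j)))

countable : ∀ {d} {S : Point d → Set} → Decidable S → (B : ℕ) → (∀ x → S x → ∀ j → ℤ.∣ Vec.lookup x j ∣ ℕ.≤ B) → Σ ℕ (HasCount S)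
countable {d} S? B bounded = length xs , xs , refl , UniqueP.filter⁺ S? (vectors-unique d (integersWithin B) (integersWithin-unique B)) , λ x →
    (λ x∈S → ∈-filter⁺ S? (vectors-complete d (integersWithin B) x (λ j → integersWithin-complete B _ (bounded x x∈S j))) x∈S)
  , (λ x∈xs → proj₂ (∈-filter⁻ S? {xs = vectors d (integersWithin B)} x∈xs))
  where
  xs = List.filter S? (vectors d (integersWithin B))

-- The simplex conv(0, (m, w), e₁, …, eₙ) ⊂ ℚ^(1+n)

module Simplex {n : ℕ} (m′ : ℕ) (w : Fin n → ℤ) where

  open import Data.Rational using (_+_; _*_; _-_; -_)

  open +-*-Solver

  m : ℕ
  m = suc m′

  mq : ℚ
  mq = toℚ (+ m)

  wq : Fin n → ℚ
  wq j = toℚ (w j)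

  vertexCoord : Fin (suc (suc n)) → Fin (suc n) → ℤ
  vertexCoord zero          _       = + 0
  vertexCoord (suc zero)    zero    = + m
  vertexCoord (suc zero)    (suc j) = w j
  vertexCoord (suc (suc k)) zero    = + 0
  vertexCoord (suc (suc k)) (suc j) = δ k j

  vertex : Fin (suc (suc n)) → Point (suc n)
  vertex i = Vec.tabulate (vertexCoord i)

  V : IntegralPolytope (suc n)
  V = List.tabulate vertex

  -- Σₖ aₖ vₖ₊₁ over the vertices other than the origin
  combination : (Fin (suc n) → ℚ) → QPoint (suc n)
  combination a zero    = mq * a zero
  combination a (suc j) = wq j * a zero + a (suc j)

  ∑-vertices : ∀ T (c : Fin (suc (suc n)) → ℚ) j →
    ∑ (suc (suc n)) (λ i → c i * (toℚ (+ T) * toℚ (Vec.lookup (vertex i) j))) ≡ toℚ (+ T) * combination (λ k → c (suc k)) j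
  ∑-vertices T c j = trans (∑-cong (suc (suc n)) (λ i → cong (λ z → c i * (t * toℚ z)) (VecP.lookup∘tabulate (vertexCoord i) j))) (expand j)
    where
    t = toℚ (+ T)
    expand : ∀ j → ∑ (suc (suc n)) (λ i → c i * (t * toℚ (vertexCoord i j))) ≡ t * combination (λ k → c (suc k)) j
    expand zero = begin
      c zero * (t * 0ℚ) + (c (suc zero) * (t * mq) + ∑ n (λ k → c (suc (suc k)) * (t * 0ℚ)))
        ≡⟨ cong (λ s → c zero * (t * 0ℚ) + (c (suc zero) * (t * mq) + s))
                (trans (∑-cong n (λ k → trans (cong (c (suc (suc k)) *_) (ℚP.*-zeroʳ t)) (ℚP.*-zeroʳ (c (suc (suc k)))))) (∑-zero n)) ⟩
      c zero * (t * 0ℚ) + (c (suc zero) * (t * mq) + 0ℚ)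
        ≡⟨ solve 4 (λ c₀ c₁ t m → c₀ :* (t :* con 0ℚ) :+ (c₁ :* (t :* m) :+ con 0ℚ) := t :* (m :* c₁)) refl (c zero) (c (suc zero)) t mq ⟩
      t * (mq * c (suc zero)) ∎
    expand (suc j) = begin
      c zero * (t * 0ℚ) + (c (suc zero) * (t * wq j) + ∑ n (λ k → c (suc (suc k)) * (t * toℚ (δ k j))))
        ≡⟨ cong (λ s → c zero * (t * 0ℚ) + (c (suc zero) * (t * wq j) + s))
                (trans (∑-cong n (λ k → sym (ℚP.*-assoc (c (suc (suc k))) t _))) (∑-δ n (λ k → c (suc (suc k)) * t) j)) ⟩
      c zero * (t * 0ℚ) + (c (suc zero) * (t * wq j) + c (suc (suc j)) * t)
        ≡⟨ solve 5 (λ c₀ c₁ cⱼ t w → c₀ :* (t :* con 0ℚ) :+ (c₁ :* (t :* w) :+ cⱼ :* t) := t :* (w :* c₁ :+ cⱼ))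
                 refl (c zero) (c (suc zero)) (c (suc (suc j))) t (wq j) ⟩
      t * (wq j * c (suc zero) + c (suc (suc j))) ∎

  combination-scale : ∀ a r j → combination (λ k → a k * r) j ≡ combination a j * r
  combination-scale a r zero    = sym (ℚP.*-assoc mq (a zero) r)
  combination-scale a r (suc j) = solve 4 (λ w a₀ aⱼ r → w :* (a₀ :* r) :+ aⱼ :* r := (w :* a₀ :+ aⱼ) :* r) refl (wq j) (a zero) (a (suc j)) r

  -- m times the barycentric coordinates with respect to (m, w), e₁, …, eₙ
  β⁺ : QPoint (suc n) → Fin (suc n) → ℚ
  β⁺ y zero    = y zero
  β⁺ y (suc j) = mq * y (suc j) - wq j * y zero

  -- m T times the barycentric coordinates of y in T · conv(V), the origin's first (they sum to m T)
  β : ℕ → QPoint (suc n) → Fin (suc (suc n)) → ℚ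
  β T y zero    = mq * toℚ (+ T) - ∑ (suc n) (β⁺ y)
  β T y (suc k) = β⁺ y k

  β⁺-cong : ∀ {y y′} → (∀ j → y j ≡ y′ j) → ∀ k → β⁺ y k ≡ β⁺ y′ k
  β⁺-cong y≗y′ zero    = y≗y′ zero
  β⁺-cong y≗y′ (suc j) = cong₂ (λ a b → mq * a - wq j * b) (y≗y′ (suc j)) (y≗y′ zero)

  β-cong : ∀ T {y y′} → (∀ j → y j ≡ y′ j) → ∀ k → β T y k ≡ β T y′ k
  β-cong T y≗y′ zero    = cong (λ s → mq * toℚ (+ T) - s) (∑-cong (suc n) (β⁺-cong y≗y′))
  β-cong T y≗y′ (suc k) = β⁺-cong y≗y′ k

  β⁺-combination : ∀ t a k → β⁺ (λ j → t * combination a j) k ≡ mq * t * a k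
  β⁺-combination t a zero    = solve 3 (λ t m a → t :* (m :* a) := m :* t :* a) refl t mq (a zero)
  β⁺-combination t a (suc j) =
    solve 5 (λ m t w a₀ aⱼ → m :* (t :* (w :* a₀ :+ aⱼ)) :- w :* (t :* (m :* a₀)) := m :* t :* aⱼ) refl mq t (wq j) (a zero) (a (suc j))

  combination-β⁺ : ∀ y j → combination (β⁺ y) j ≡ mq * y j
  combination-β⁺ y zero    = refl
  combination-β⁺ y (suc j) = solve 4 (λ w y₀ yⱼ m → w :* y₀ :+ (m :* yⱼ :- w :* y₀) := m :* yⱼ) refl (wq j) (y zero) (y (suc j)) mq

  ∑-β : ∀ T y → ∑ (suc (suc n)) (β T y) ≡ mq * toℚ (+ T)
  ∑-β T y = solve 2 (λ a s → (a :- s) :+ s := a) refl (mq * toℚ (+ T)) (∑ (suc n) (β⁺ y))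

  β-weights : ∀ T y (c : Fin (suc (suc n)) → ℚ) → ∑ (suc (suc n)) c ≡ 1ℚ →
              (∀ j → ∑ (suc (suc n)) (λ i → c i * (toℚ (+ T) * toℚ (Vec.lookup (vertex i) j))) ≡ y j) →
              ∀ i → β T y i ≡ mq * toℚ (+ T) * c i
  β-weights T y c ∑c≡1 c-comb = weights
    where
    t = toℚ (+ T)
    M = mq * t
    S = ∑ (suc n) (λ k → c (suc k))
    β⁺-weights : ∀ k → β⁺ y k ≡ M * c (suc k)
    β⁺-weights k = trans (β⁺-cong (λ j → trans (sym (c-comb j)) (∑-vertices T c j)) k) (β⁺-combination t (λ k → c (suc k)) k)
    weights : ∀ i → β T y i ≡ M * c i
    weights zero = begin
      M - ∑ (suc n) (β⁺ y)    ≡⟨ cong (λ s → M - s) (trans (∑-cong (suc n) β⁺-weights) (sym (*-distribˡ-∑ (suc n) M (λ k → c (suc k))))) ⟩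
      M - M * S               ≡⟨ solve 2 (λ M S → M :- M :* S := M :* (con 1ℚ :- S)) refl M S ⟩
      M * (1ℚ - S)            ≡⟨ cong (λ z → M * (z - S)) (sym ∑c≡1) ⟩
      M * ((c zero + S) - S)  ≡⟨ solve 3 (λ M c₀ S → M :* ((c₀ :+ S) :- S) := M :* c₀) refl M (c zero) S ⟩
      M * c zero              ∎
    weights (suc k) = β⁺-weights k

  module _ (T′ : ℕ) (y : QPoint (suc n)) where
    private
      t = toℚ (+ suc T′)
      r = 1/suc (T′ ℕ.+ m′ ℕ.* suc T′)
      mtr≡1 : mq * t * r ≡ 1ℚ
      mtr≡1 = trans (cong (_* r) (sym (toℚ-homo-* (+ m) (+ suc T′)))) (*-1/suc (T′ ℕ.+ m′ ℕ.* suc T′))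

    normalisedβ : Fin (suc (suc n)) → ℚ
    normalisedβ i = β (suc T′) y i * r

    normalisedβ-nonneg : (∀ i → 0ℚ ℚ.≤ β (suc T′) y i) → ∀ i → 0ℚ ℚ.≤ normalisedβ i
    normalisedβ-nonneg β≥0 i = 0≤* (β≥0 i) (ℚP.<⇒≤ (1/suc-pos _))

    ∑-normalisedβ : ∑ (suc (suc n)) normalisedβ ≡ 1ℚ
    ∑-normalisedβ = trans (sym (*-distribʳ-∑ (suc (suc n)) r (β (suc T′) y))) (trans (cong (_* r) (∑-β (suc T′) y)) mtr≡1)

    normalisedβ-combination : ∀ j → ∑ (suc (suc n)) (λ i → normalisedβ i * (t * toℚ (Vec.lookup (vertex i) j))) ≡ y j
    normalisedβ-combination j = begin
      ∑ (suc (suc n)) (λ i → normalisedβ i * (t * toℚ (Vec.lookup (vertex i) j)))  ≡⟨ ∑-vertices (suc T′) normalisedβ j ⟩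
      t * combination (λ k → β⁺ y k * r) j                                         ≡⟨ cong (t *_) (combination-scale (β⁺ y) r j) ⟩
      t * (combination (β⁺ y) j * r)                                               ≡⟨ cong (λ z → t * (z * r)) (combination-β⁺ y j) ⟩
      t * (mq * y j * r)                                                           ≡⟨ solve 4 (λ t m y r → t :* (m :* y :* r) := y :* (m :* t :* r)) refl t mq (y j) r ⟩
      y j * (mq * t * r)                                                           ≡⟨ cong (y j *_) mtr≡1 ⟩
      y j * 1ℚ                                                                     ≡⟨ ℚP.*-identityʳ (y j) ⟩
      y j                                                                          ∎

  inDilate⇒β≥0 : ∀ T y → InDilate V T y → ∀ i → 0ℚ ℚ.≤ β T y i
  inDilate⇒β≥0 T y y∈ i = weights-nonneg (InDilate-tabulate⁻ {T = T} {y} vertex y∈)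
    where
    weights-nonneg : InDilateᶠ vertex T y → 0ℚ ℚ.≤ β T y i
    weights-nonneg (c , c≥0 , ∑c≡1 , c-comb) =
      subst (0ℚ ℚ.≤_) (sym (β-weights T y c ∑c≡1 c-comb i)) (0≤* (0≤* (toℚ-nonneg m) (toℚ-nonneg T)) (c≥0 i))

  β≥0⇒inDilate : ∀ T′ y → (∀ i → 0ℚ ℚ.≤ β (suc T′) y i) → InDilate V (suc T′) y
  β≥0⇒inDilate T′ y β≥0 =
    InDilate-tabulate⁺ {T = suc T′} {y} vertex (normalisedβ T′ y , normalisedβ-nonneg T′ y β≥0 , ∑-normalisedβ T′ y , normalisedβ-combination T′ y)

  β⁺-affine : ∀ y s z k → β⁺ (λ j → y j + s * z j) k ≡ β⁺ y k + s * β⁺ z k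
  β⁺-affine y s z zero    = refl
  β⁺-affine y s z (suc j) =
    solve 7 (λ m w s y₀ yⱼ z₀ zⱼ → m :* (yⱼ :+ s :* zⱼ) :- w :* (y₀ :+ s :* z₀) := (m :* yⱼ :- w :* y₀) :+ s :* (m :* zⱼ :- w :* z₀))
      refl mq (wq j) s (y zero) (y (suc j)) (z zero) (z (suc j))

  β-affine : ∀ T y s z k → β T (λ j → y j + s * z j) k ≡ β T y k + s * β 0 z k
  β-affine T y s z zero = begin
    mq * t - ∑ (suc n) (β⁺ (λ j → y j + s * z j))               ≡⟨ cong (λ u → mq * t - u) (∑-cong (suc n) (β⁺-affine y s z)) ⟩
    mq * t - ∑ (suc n) (λ k → β⁺ y k + s * β⁺ z k)              ≡⟨ cong (λ u → mq * t - u) (∑-distrib-+ (suc n) (β⁺ y) (λ k → s * β⁺ z k)) ⟩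
    mq * t - (∑ (suc n) (β⁺ y) + ∑ (suc n) (λ k → s * β⁺ z k))  ≡⟨ cong (λ u → mq * t - (∑ (suc n) (β⁺ y) + u)) (*-distribˡ-∑ (suc n) s (β⁺ z)) ⟨
    mq * t - (∑ (suc n) (β⁺ y) + s * ∑ (suc n) (β⁺ z))          ≡⟨ solve 5 (λ m t Y s Z → m :* t :- (Y :+ s :* Z) := (m :* t :- Y) :+ s :* (m :* con 0ℚ :- Z))
                                                               refl mq t (∑ (suc n) (β⁺ y)) s (∑ (suc n) (β⁺ z)) ⟩
    β T y zero + s * β 0 z zero                             ∎
    where t = toℚ (+ T)
  β-affine T y s z (suc k) = β⁺-affine y s z k

  unit : Fin (suc n) → QPoint (suc n)
  unit i k = toℚ (δ k i)

  β-shift : ∀ T y i s k → β T (shift y i s) k ≡ β T y k + s * β 0 (unit i) k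
  β-shift T y i s k = trans (β-cong T (shift-δ y i s) k) (β-affine T y s (unit i) k)

  β⁺ℤ : Point (suc n) → Fin (suc n) → ℤ
  β⁺ℤ x zero    = Vec.lookup x zero
  β⁺ℤ x (suc j) = + m ℤ.* Vec.lookup x (suc j) ℤ.- w j ℤ.* Vec.lookup x zero

  βℤ : ℕ → Point (suc n) → Fin (suc (suc n)) → ℤ
  βℤ T x zero    = + m ℤ.* + T ℤ.- ℤΣ.sum (β⁺ℤ x)
  βℤ T x (suc k) = β⁺ℤ x k

  toℚ-β⁺ℤ : ∀ x k → toℚ (β⁺ℤ x k) ≡ β⁺ (embed x) k
  toℚ-β⁺ℤ x zero    = refl
  toℚ-β⁺ℤ x (suc j) = trans (toℚ-homo-- (+ m ℤ.* Vec.lookup x (suc j)) (w j ℤ.* Vec.lookup x zero))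
                           (cong₂ _-_ (toℚ-homo-* (+ m) (Vec.lookup x (suc j))) (toℚ-homo-* (w j) (Vec.lookup x zero)))

  toℚ-βℤ : ∀ T x k → toℚ (βℤ T x k) ≡ β T (embed x) k
  toℚ-βℤ T x zero    = begin
    toℚ (+ m ℤ.* + T ℤ.- ℤΣ.sum (β⁺ℤ x))              ≡⟨ toℚ-homo-- (+ m ℤ.* + T) (ℤΣ.sum (β⁺ℤ x)) ⟩
    toℚ (+ m ℤ.* + T) - toℚ (ℤΣ.sum (β⁺ℤ x))          ≡⟨ cong₂ _-_ (toℚ-homo-* (+ m) (+ T)) (toℚ-homo-sum (suc n) (β⁺ℤ x)) ⟩
    mq * toℚ (+ T) - ∑ (suc n) (λ k → toℚ (β⁺ℤ x k))  ≡⟨ cong (λ s → mq * toℚ (+ T) - s) (∑-cong (suc n) (toℚ-β⁺ℤ x)) ⟩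
    β T (embed x) zero                                ∎
  toℚ-βℤ T x (suc k) = toℚ-β⁺ℤ x k

  sum-βℤ : ∀ T x → ℤΣ.sum (βℤ T x) ≡ + m ℤ.* + T
  sum-βℤ T x = complement (+ m ℤ.* + T) (ℤΣ.sum (β⁺ℤ x))
    where
    complement : ∀ a s → (a ℤ.- s) ℤ.+ s ≡ a
    complement = ℤSolver.solve-∀

  βℤ-injective : ∀ T {x x′} → (∀ k → βℤ T x k ≡ βℤ T x′ k) → x ≡ x′
  βℤ-injective T {x} {x′} βx≗βx′ = lookup-ext coordinates
    where
    x₀≡x′₀ = βx≗βx′ (suc zero)
    coordinates : ∀ j → Vec.lookup x j ≡ Vec.lookup x′ j
    coordinates zero    = x₀≡x′₀
    coordinates (suc j) = ℤP.*-cancelˡ-≡ (+ m) _ _ (begin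
      + m ℤ.* Vec.lookup x (suc j)                   ≡⟨ restore (+ m ℤ.* Vec.lookup x (suc j)) (w j ℤ.* Vec.lookup x zero) ⟨
      β⁺ℤ x (suc j) ℤ.+ w j ℤ.* Vec.lookup x zero    ≡⟨ cong₂ (λ b x₀ → b ℤ.+ w j ℤ.* x₀) (βx≗βx′ (suc (suc j))) x₀≡x′₀ ⟩
      β⁺ℤ x′ (suc j) ℤ.+ w j ℤ.* Vec.lookup x′ zero  ≡⟨ restore (+ m ℤ.* Vec.lookup x′ (suc j)) (w j ℤ.* Vec.lookup x′ zero) ⟩
      + m ℤ.* Vec.lookup x′ (suc j)                                      ∎)
      where
      restore : ∀ a b → (a ℤ.- b) ℤ.+ b ≡ a
      restore = ℤSolver.solve-∀

  latticePoint⇒βℤ≥0 : ∀ T x → LatticePts V T x → ∀ k → + 0 ℤ.≤ βℤ T x k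
  latticePoint⇒βℤ≥0 T x x∈ k = toℚ-cancel-≤ (subst (0ℚ ℚ.≤_) (sym (toℚ-βℤ T x k)) (inDilate⇒β≥0 T (embed x) x∈ k))

  βℤ≥0⇒latticePoint : ∀ T′ x → (∀ k → + 0 ℤ.≤ βℤ (suc T′) x k) → LatticePts V (suc T′) x
  βℤ≥0⇒latticePoint T′ x βℤ≥0 = β≥0⇒inDilate T′ (embed x) (λ k → subst (0ℚ ℚ.≤_) (toℚ-βℤ (suc T′) x k) (toℚ-mono-≤ (βℤ≥0 k)))

  module Interior (w-range : ∀ j → -[1+ 0 ] ℤ.≤ w j × w j ℤ.≤ + 0) (Σw-bound : ℤ.- ℤΣ.sum w ℤ.< + m) where

    private
      A : ℚ
      A = - ∑ n wq

      A≡ : toℚ (ℤ.- ℤΣ.sum w) ≡ A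
      A≡ = trans (toℚ-homo‿- (ℤΣ.sum w)) (cong -_ (toℚ-homo-sum n w))

      A≥0 : 0ℚ ℚ.≤ A
      A≥0 = subst (0ℚ ℚ.≤_) A≡ (toℚ-mono-≤ (ℤP.neg-mono-≤ (subst (ℤΣ.sum w ℤ.≤_) (ℤΣ.sum-replicate-zero n)
              (sumℤ-mono n (λ j → proj₂ (w-range j))))))

      1+A≤m : 1ℚ + A ℚ.≤ mq
      1+A≤m = subst₂ ℚ._≤_ (trans (toℚ-homo-+ (+ 1) (ℤ.- ℤΣ.sum w)) (cong (λ u → 1ℚ + u) A≡)) refl (toℚ-mono-≤ (ℤP.i<j⇒suc[i]≤j Σw-bound))

      -wq-range : ∀ j → 0ℚ ℚ.≤ - wq j × - wq j ℚ.≤ 1ℚ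
      -wq-range j = subst (0ℚ ℚ.≤_) (toℚ-homo‿- (w j)) (toℚ-mono-≤ (ℤP.neg-mono-≤ (proj₂ (w-range j))))
                  , subst (ℚ._≤ 1ℚ) (toℚ-homo‿- (w j)) (toℚ-mono-≤ (ℤP.neg-mono-≤ (proj₁ (w-range j))))

    β-unit₀₀ : β 0 (unit zero) zero ≡ - (1ℚ + A)
    β-unit₀₀ = begin
      mq * 0ℚ - (1ℚ + ∑ n (λ j → mq * 0ℚ - wq j * 1ℚ))  ≡⟨ cong (λ u → mq * 0ℚ - (1ℚ + u)) (∑-cong n (λ j → minus-one j)) ⟩
      mq * 0ℚ - (1ℚ + ∑ n (λ j → - 1ℚ * wq j))          ≡⟨ cong (λ u → mq * 0ℚ - (1ℚ + u)) (*-distribˡ-∑ n (- 1ℚ) wq) ⟨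
      mq * 0ℚ - (1ℚ + - 1ℚ * ∑ n wq)                    ≡⟨ solve 2 (λ m s → m :* con 0ℚ :- (con 1ℚ :+ :- con 1ℚ :* s) := :- (con 1ℚ :+ :- s)) refl mq (∑ n wq) ⟩
      - (1ℚ + A)                                        ∎
      where
      minus-one : ∀ j → mq * 0ℚ - wq j * 1ℚ ≡ - 1ℚ * wq j
      minus-one j = solve 2 (λ m w → m :* con 0ℚ :- w :* con 1ℚ := :- con 1ℚ :* w) refl mq (wq j)

    β-unitₛₛ : ∀ j → β 0 (unit (suc j)) (suc (suc j)) ≡ mq
    β-unitₛₛ j = begin
      mq * toℚ (δ j j) - wq j * 0ℚ  ≡⟨ cong (λ z → mq * toℚ z - wq j * 0ℚ) (δ-refl j) ⟩
      mq * 1ℚ - wq j * 0ℚ           ≡⟨ solve 2 (λ m w → m :* con 1ℚ :- w :* con 0ℚ := m) refl mq (wq j) ⟩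
      mq                            ∎

    Bounded : ℚ → Set
    Bounded x = - mq ℚ.≤ x × x ℚ.≤ mq

    private
      1≤m : 1ℚ ℚ.≤ mq
      1≤m = toℚ-mono-≤ {+ 1} {+ m} (ℤ.+≤+ (ℕ.s≤s ℕ.z≤n))

      bounded-nonneg : ∀ {x} → 0ℚ ℚ.≤ x → x ℚ.≤ mq → Bounded x
      bounded-nonneg x≥0 x≤m = ℚP.≤-trans (ℚP.neg-antimono-≤ (ℚP.≤-trans x≥0 x≤m)) x≥0 , x≤m

      bounded-unit : ∀ {x} → 0ℚ ℚ.≤ x → x ℚ.≤ 1ℚ → Bounded x
      bounded-unit x≥0 x≤1 = bounded-nonneg x≥0 (ℚP.≤-trans x≤1 1≤m)

      bounded-neg : ∀ {x} → Bounded x → Bounded (- x)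
      bounded-neg {x} (-m≤x , x≤m) = ℚP.neg-antimono-≤ x≤m , subst (- x ℚ.≤_) (solve 1 (λ m → :- (:- m) := m) refl mq) (ℚP.neg-antimono-≤ -m≤x)

      0≤1 : 0ℚ ℚ.≤ 1ℚ
      0≤1 = toℚ-nonneg 1

    -- By β-shift, moving y by s along eᵢ changes βₖ by s · β 0 (unit i) k; these rates are at most m in size.
    direction-bounded : ∀ i k → Bounded (β 0 (unit i) k)
    direction-bounded zero zero = subst Bounded (sym β-unit₀₀)
      (bounded-neg (bounded-nonneg (ℚP.≤-trans A≥0 (subst (ℚ._≤ 1ℚ + A) (ℚP.+-identityˡ A) (ℚP.+-monoˡ-≤ A 0≤1))) 1+A≤m))
    direction-bounded zero (suc zero) = bounded-unit 0≤1 ℚP.≤-refl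
    direction-bounded zero (suc (suc j)) = subst Bounded (sym value) (bounded-unit (proj₁ (-wq-range j)) (proj₂ (-wq-range j)))
      where
      value : mq * 0ℚ - wq j * 1ℚ ≡ - wq j
      value = solve 2 (λ m w → m :* con 0ℚ :- w :* con 1ℚ := :- w) refl mq (wq j)
    direction-bounded (suc i) zero = subst Bounded (sym value) (bounded-neg (bounded-nonneg (toℚ-nonneg m) ℚP.≤-refl))
      where
      value : mq * 0ℚ - (0ℚ + ∑ n (λ j → mq * toℚ (δ j i) - wq j * 0ℚ)) ≡ - mq
      value = begin
        mq * 0ℚ - (0ℚ + ∑ n (λ j → mq * toℚ (δ j i) - wq j * 0ℚ))  ≡⟨ cong (λ u → mq * 0ℚ - (0ℚ + u)) (∑-cong n drop-w) ⟩
        mq * 0ℚ - (0ℚ + ∑ n (λ j → mq * toℚ (δ j i)))              ≡⟨ cong (λ u → mq * 0ℚ - (0ℚ + u)) (∑-δ n (λ _ → mq) i) ⟩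
        mq * 0ℚ - (0ℚ + mq)                                        ≡⟨ solve 1 (λ m → m :* con 0ℚ :- (con 0ℚ :+ m) := :- m) refl mq ⟩
        - mq                                                       ∎
        where
        drop-w : ∀ j → mq * toℚ (δ j i) - wq j * 0ℚ ≡ mq * toℚ (δ j i)
        drop-w j = solve 3 (λ m d w → m :* d :- w :* con 0ℚ := m :* d) refl mq (toℚ (δ j i)) (wq j)
    direction-bounded (suc i) (suc zero) = bounded-unit ℚP.≤-refl 0≤1
    direction-bounded (suc i) (suc (suc j)) with δ j i | δ-01 j i
    ... | _ | inj₁ refl = subst Bounded (sym (solve 2 (λ m w → m :* con 0ℚ :- w :* con 0ℚ := con 0ℚ) refl mq (wq j))) (bounded-unit ℚP.≤-refl 0≤1)
    ... | _ | inj₂ refl = subst Bounded (sym (solve 2 (λ m w → m :* con 1ℚ :- w :* con 0ℚ := m) refl mq (wq j))) (bounded-nonneg (toℚ-nonneg m) ℚP.≤-refl)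

    private
      perturbation : ∀ {ε b D} → 0ℚ ℚ.≤ ε → mq * ε ℚ.≤ b → Bounded D → 0ℚ ℚ.≤ b + ε * D
      perturbation {ε} {b} {D} ε≥0 mε≤b (-m≤D , _) =
        subst₂ ℚ._≤_ (ℚP.+-inverseʳ (mq * ε)) refl
          (ℚP.+-mono-≤ mε≤b (subst (ℚ._≤ ε * D) (solve 2 (λ e m → e :* (:- m) := :- (m :* e)) refl ε mq)
                                   (ℚP.*-monoˡ-≤-nonNeg ε {{ℚ.nonNegative ε≥0}} -m≤D)))

      positive-of-perturbed : ∀ {b p} → 0ℚ ℚ.≤ b + p → p ℚ.< 0ℚ → 0ℚ ℚ.< b
      positive-of-perturbed {b} {p} b+p≥0 p<0 =
        subst₂ ℚ._<_ (ℚP.+-identityˡ 0ℚ) (solve 2 (λ b p → (b :+ p) :+ (:- p) := b) refl b p)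
          (ℚP.+-mono-≤-< b+p≥0 (ℚP.neg-antimono-< p<0))

      negative-product : ∀ {ε q} → 0ℚ ℚ.< ε → 0ℚ ℚ.< q → - (ε * q) ℚ.< 0ℚ
      negative-product {ε} {q} ε>0 q>0 =
        ℚP.neg-antimono-< (ℚP.positive⁻¹ _ {{ℚP.pos*pos⇒pos ε {{ℚ.positive ε>0}} q {{ℚ.positive q>0}}}})

    margin⇒interior : ∀ T′ y ε → 0ℚ ℚ.< ε → (∀ k → mq * ε ℚ.≤ β (suc T′) y k) → InInterior V (suc T′) y
    margin⇒interior T′ y ε ε>0 margin = ε , ε>0 , λ i →
        β≥0⇒inDilate T′ _ (λ k → shifted i ε k (perturbation ε≥0 (margin k) (direction-bounded i k)))
      , β≥0⇒inDilate T′ _ (λ k → shifted i (- ε) k (subst (0ℚ ℚ.≤_) (flip-sign (β (suc T′) y k) (β 0 (unit i) k))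
                                                   (perturbation ε≥0 (margin k) (bounded-neg (direction-bounded i k)))))
      where
      ε≥0 = ℚP.<⇒≤ ε>0
      shifted : ∀ i s k → 0ℚ ℚ.≤ β (suc T′) y k + s * β 0 (unit i) k → 0ℚ ℚ.≤ β (suc T′) (shift y i s) k
      shifted i s k = subst (0ℚ ℚ.≤_) (sym (β-shift (suc T′) y i s k))
      flip-sign : ∀ b D → b + ε * (- D) ≡ b + (- ε) * D
      flip-sign b D = solve 3 (λ b e D → b :+ e :* (:- D) := b :+ (:- e) :* D) refl b ε D

    -- Each βₖ strictly decreases along one of the directions ±eᵢ, and the ε-shifts stay inside.
    interior⇒β>0 : ∀ T y → InInterior V T y → ∀ k → 0ℚ ℚ.< β T y k
    interior⇒β>0 T y (ε , ε>0 , inside) = positivity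
      where
      positive : ∀ i s k → InDilate V T (shift y i s) → s * β 0 (unit i) k ℚ.< 0ℚ → 0ℚ ℚ.< β T y k
      positive i s k y∈ = positive-of-perturbed (subst (0ℚ ℚ.≤_) (β-shift T y i s k) (inDilate⇒β≥0 T _ y∈ k))
      1+A>0 : 0ℚ ℚ.< 1ℚ + A
      1+A>0 = ℚP.<-≤-trans (1/suc-pos 0) (subst (ℚ._≤ 1ℚ + A) (ℚP.+-identityʳ 1ℚ) (ℚP.+-monoʳ-≤ 1ℚ A≥0))
      positivity : ∀ k → 0ℚ ℚ.< β T y k
      positivity zero = positive zero ε zero (proj₁ (inside zero))
        (subst (ℚ._< 0ℚ) (trans (ℚP.neg-distribʳ-* ε (1ℚ + A)) (cong (ε *_) (sym β-unit₀₀))) (negative-product ε>0 1+A>0))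
      positivity (suc zero) = positive zero (- ε) (suc zero) (proj₂ (inside zero))
        (subst (ℚ._< 0ℚ) (ℚP.neg-distribˡ-* ε 1ℚ) (negative-product ε>0 (1/suc-pos 0)))
      positivity (suc (suc j)) = positive (suc j) (- ε) (suc (suc j)) (proj₂ (inside (suc j)))
        (subst (ℚ._< 0ℚ) (trans (ℚP.neg-distribˡ-* ε mq) (cong (- ε *_) (sym (β-unitₛₛ j)))) (negative-product ε>0 (ℚP.<-≤-trans (1/suc-pos 0) 1≤m)))

    interiorPoint⇒βℤ>0 : ∀ T x → InteriorLatticePts V T x → ∀ k → + 0 ℤ.< βℤ T x k
    interiorPoint⇒βℤ>0 T x x∈ k = toℚ-cancel-< (subst (0ℚ ℚ.<_) (sym (toℚ-βℤ T x k)) (interior⇒β>0 T (embed x) x∈ k))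

    -- Positive integral βₖ are at least 1 = m · (1 / m), a margin for ε = 1 / m.
    βℤ>0⇒interiorPoint : ∀ T′ x → (∀ k → + 0 ℤ.< βℤ (suc T′) x k) → InteriorLatticePts V (suc T′) x
    βℤ>0⇒interiorPoint T′ x βℤ>0 = margin⇒interior T′ (embed x) (1/suc m′) (1/suc-pos m′) λ k →
      subst₂ ℚ._≤_ (sym (*-1/suc m′)) (toℚ-βℤ (suc T′) x k) (toℚ-mono-≤ (ℤP.i<j⇒suc[i]≤j (βℤ>0 k)))

    -- (n + 2) times the barycentre of the vertices
    centroid : Point (suc n)
    centroid = + m ∷ Vec.tabulate (λ j → + 1 ℤ.+ w j)

    βℤ-centroid : ∀ k → βℤ (suc (suc n)) centroid k ≡ + m
    βℤ-centroid zero = begin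
      + m ℤ.* + suc (suc n) ℤ.- (+ m ℤ.+ ℤΣ.sum (λ j → β⁺ℤ centroid (suc j)))  ≡⟨ cong (λ s → + m ℤ.* + suc (suc n) ℤ.- (+ m ℤ.+ s))
                                                                                     (trans (ℤΣ.sum-cong-≗ (λ j → βℤ-centroid (suc (suc j)))) (sumℤ-const n (+ m))) ⟩
      + m ℤ.* + suc (suc n) ℤ.- (+ m ℤ.+ + n ℤ.* + m)                          ≡⟨ cong (λ k → + m ℤ.* k ℤ.- (+ m ℤ.+ + n ℤ.* + m)) (ℤP.pos-+ 2 n) ⟩
      + m ℤ.* (+ 2 ℤ.+ + n) ℤ.- (+ m ℤ.+ + n ℤ.* + m)                          ≡⟨ collect (+ m) (+ n) ⟩
      + m                                                                      ∎
      where
      collect : ∀ m n → m ℤ.* (+ 2 ℤ.+ n) ℤ.- (m ℤ.+ n ℤ.* m) ≡ m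
      collect = ℤSolver.solve-∀
    βℤ-centroid (suc zero)          = refl
    βℤ-centroid (suc (suc j)) = begin
      + m ℤ.* Vec.lookup (Vec.tabulate (λ j → + 1 ℤ.+ w j)) j ℤ.- w j ℤ.* + m  ≡⟨ cong (λ z → + m ℤ.* z ℤ.- w j ℤ.* + m) (VecP.lookup∘tabulate _ j) ⟩
      + m ℤ.* (+ 1 ℤ.+ w j) ℤ.- w j ℤ.* + m                                    ≡⟨ cancel (+ m) (w j) ⟩
      + m                                                                      ∎
      where
      cancel : ∀ m w → m ℤ.* (+ 1 ℤ.+ w) ℤ.- w ℤ.* m ≡ m
      cancel = ℤSolver.solve-∀

    fullDim : FullDim V
    fullDim = _ , InInterior-shrink V (suc n) (embed centroid)
      (βℤ>0⇒interiorPoint (suc n) centroid (λ k → subst (+ 0 ℤ.<_) (sym (βℤ-centroid k)) (ℤ.+<+ (ℕ.s≤s ℕ.z≤n))))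

-- The simplices S(a, e)

negPrefix : ℕ → ∀ {n} → Fin n → ℤ
negPrefix zero    j       = + 0
negPrefix (suc a) zero    = -[1+ 0 ]
negPrefix (suc a) (suc j) = negPrefix a j

negPrefix-values : ∀ a {n} (j : Fin n) → negPrefix a j ≡ + 0 ⊎ negPrefix a j ≡ -[1+ 0 ]
negPrefix-values zero    j       = inj₁ refl
negPrefix-values (suc a) zero    = inj₂ refl
negPrefix-values (suc a) (suc j) = negPrefix-values a j

sum-negPrefix : ∀ a n → a ℕ.≤ n → ℤΣ.sum {n} (negPrefix a) ≡ ℤ.- + a
sum-negPrefix zero    n       _           = ℤΣ.sum-replicate-zero n
sum-negPrefix (suc a) (suc n) (ℕ.s≤s a≤n) = begin
  -[1+ 0 ] ℤ.+ ℤΣ.sum {n} (negPrefix a)  ≡⟨ cong (λ s → -[1+ 0 ] ℤ.+ s) (sum-negPrefix a n a≤n) ⟩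
  -[1+ 0 ] ℤ.+ ℤ.- + a                   ≡⟨ ℤP.neg-distrib-+ (+ 1) (+ a) ⟨
  ℤ.- (+ 1 ℤ.+ + a)                      ≡⟨ cong ℤ.-_ (ℤP.pos-+ 1 a) ⟨
  ℤ.- + suc a                            ∎

Code : ℕ → Set
Code n = ℕ × ℕ × Vec ℤ n

GoodCode : ℕ → ℕ → ∀ {n} → Code n → Set
GoodCode m T (q , r , y) = r ℕ.< m × (∀ j → + 0 ℤ.≤ Vec.lookup y j) × ℤΣ.sum (Vec.lookup y) ℤ.+ + (q ℕ.+ r) ℤ.≤ + T

code-q+r≤T : ∀ {m T} n {q r} {y : Vec ℤ n} → GoodCode m T (q , r , y) → q ℕ.+ r ℕ.≤ T
code-q+r≤T n {q} {r} {y} (_ , y≥0 , S≤T) =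
  ℤP.drop‿+≤+ (ℤP.≤-trans (subst (ℤ._≤ ℤΣ.sum (Vec.lookup y) ℤ.+ + (q ℕ.+ r)) (ℤP.+-identityˡ _) (ℤP.+-monoˡ-≤ (+ (q ℕ.+ r)) (sumℤ-nonneg n y≥0))) S≤T)

module Family (n a e : ℕ) (a≤n : a ℕ.≤ n) (e≤1 : e ℕ.≤ 1) where

  open Simplex {n} (e ℕ.+ a) (negPrefix a) public

  w : Fin n → ℤ
  w = negPrefix a

  private
    w-range : ∀ j → -[1+ 0 ] ℤ.≤ w j × w j ℤ.≤ + 0
    w-range j with negPrefix-values a j
    ... | inj₁ wⱼ≡0  = subst (λ z → -[1+ 0 ] ℤ.≤ z × z ℤ.≤ + 0) (sym wⱼ≡0) (ℤ.-≤+ , ℤP.≤-refl)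
    ... | inj₂ wⱼ≡-1 = subst (λ z → -[1+ 0 ] ℤ.≤ z × z ℤ.≤ + 0) (sym wⱼ≡-1) (ℤP.≤-refl , ℤ.-≤+)

    Σw-bound : ℤ.- ℤΣ.sum w ℤ.< + m
    Σw-bound = subst (ℤ._< + m) (trans (sym (ℤP.neg-involutive (+ a))) (cong ℤ.-_ (sym (sum-negPrefix a n a≤n))))
                     (ℤ.+<+ (ℕ.s≤s (ℕP.m≤n+m a e)))

  open Interior w-range Σw-bound public

  encode : Code n → Point (suc n)
  encode (q , r , y) = + (r ℕ.+ q ℕ.* m) ∷ Vec.tabulate (λ j → Vec.lookup y j ℤ.+ + q ℤ.* w j)

  decode : Point (suc n) → Code n
  decode (+ x₀ ∷ xs)     = x₀ ℕ./ m , x₀ ℕ.% m , Vec.tabulate (λ j → Vec.lookup xs j ℤ.- + (x₀ ℕ./ m) ℤ.* w j)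
  decode (-[1+ _ ] ∷ xs) = 0 , 0 , xs  -- junk: lattice points have x₀ ≥ 0

  encode₀ : ∀ q r → + (r ℕ.+ q ℕ.* m) ≡ + r ℤ.+ + q ℤ.* + m
  encode₀ q r = trans (ℤP.pos-+ r (q ℕ.* m)) (cong (λ s → + r ℤ.+ s) (ℤP.pos-* q m))

  β⁺ℤ-encode : ∀ q r y j → β⁺ℤ (encode (q , r , y)) (suc j) ≡ + m ℤ.* Vec.lookup y j ℤ.- w j ℤ.* + r
  β⁺ℤ-encode q r y j = begin
    + m ℤ.* Vec.lookup (Vec.tabulate (λ j → Vec.lookup y j ℤ.+ + q ℤ.* w j)) j ℤ.- w j ℤ.* + (r ℕ.+ q ℕ.* m)
      ≡⟨ cong₂ (λ u v → + m ℤ.* u ℤ.- w j ℤ.* v) (VecP.lookup∘tabulate _ j) (encode₀ q r) ⟩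
    + m ℤ.* (Vec.lookup y j ℤ.+ + q ℤ.* w j) ℤ.- w j ℤ.* (+ r ℤ.+ + q ℤ.* + m)
      ≡⟨ shear (+ m) (Vec.lookup y j) (+ q) (w j) (+ r) ⟩
    + m ℤ.* Vec.lookup y j ℤ.- w j ℤ.* + r ∎
    where
    shear : ∀ m y q w r → m ℤ.* (y ℤ.+ q ℤ.* w) ℤ.- w ℤ.* (r ℤ.+ q ℤ.* m) ≡ m ℤ.* y ℤ.- w ℤ.* r
    shear = ℤSolver.solve-∀

  βℤ-encode₀ : ∀ T q r y → βℤ T (encode (q , r , y)) zero ≡ + m ℤ.* (+ T ℤ.- (ℤΣ.sum (Vec.lookup y) ℤ.+ + (q ℕ.+ r))) ℤ.+ + e ℤ.* + r
  βℤ-encode₀ T q r y = begin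
    + m ℤ.* + T ℤ.- (+ (r ℕ.+ q ℕ.* m) ℤ.+ ℤΣ.sum (λ j → β⁺ℤ (encode (q , r , y)) (suc j)))
      ≡⟨ cong₂ (λ u v → + m ℤ.* + T ℤ.- (u ℤ.+ v)) (encode₀ q r)
               (trans (ℤΣ.sum-cong-≗ (β⁺ℤ-encode q r y)) (sumℤ-linear n (Vec.lookup y) w (+ m) (+ r))) ⟩
    + m ℤ.* + T ℤ.- ((+ r ℤ.+ + q ℤ.* + m) ℤ.+ (+ m ℤ.* Sy ℤ.- ℤΣ.sum w ℤ.* + r))
      ≡⟨ cong₂ (λ M s → M ℤ.* + T ℤ.- ((+ r ℤ.+ + q ℤ.* M) ℤ.+ (M ℤ.* Sy ℤ.- s ℤ.* + r))) m≡ (sum-negPrefix a n a≤n) ⟩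
    M′ ℤ.* + T ℤ.- ((+ r ℤ.+ + q ℤ.* M′) ℤ.+ (M′ ℤ.* Sy ℤ.- ℤ.- + a ℤ.* + r))
      ≡⟨ collect (+ T) (+ q) (+ r) Sy (+ a) (+ e) ⟩
    M′ ℤ.* (+ T ℤ.- (Sy ℤ.+ (+ q ℤ.+ + r))) ℤ.+ + e ℤ.* + r
      ≡⟨ cong₂ (λ M k → M ℤ.* (+ T ℤ.- (Sy ℤ.+ k)) ℤ.+ + e ℤ.* + r) (sym m≡) (sym (ℤP.pos-+ q r)) ⟩
    + m ℤ.* (+ T ℤ.- (Sy ℤ.+ + (q ℕ.+ r))) ℤ.+ + e ℤ.* + r ∎
    where
    Sy = ℤΣ.sum (Vec.lookup y)
    M′ = + 1 ℤ.+ (+ e ℤ.+ + a)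
    m≡ : + m ≡ M′
    m≡ = trans (ℤP.pos-+ 1 (e ℕ.+ a)) (cong (λ s → + 1 ℤ.+ s) (ℤP.pos-+ e a))
    collect : ∀ T q r S a e → (+ 1 ℤ.+ (e ℤ.+ a)) ℤ.* T ℤ.- ((r ℤ.+ q ℤ.* (+ 1 ℤ.+ (e ℤ.+ a))) ℤ.+ ((+ 1 ℤ.+ (e ℤ.+ a)) ℤ.* S ℤ.- ℤ.- a ℤ.* r))
                                ≡ (+ 1 ℤ.+ (e ℤ.+ a)) ℤ.* (T ℤ.- (S ℤ.+ (q ℤ.+ r))) ℤ.+ e ℤ.* r
    collect = ℤSolver.solve-∀

  private
    negated-weight : ∀ j r → Σ ℕ λ ρ → ρ ℕ.≤ r × ℤ.- (w j ℤ.* + r) ≡ + ρ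
    negated-weight j r with w j | negPrefix-values a j
    ... | _ | inj₁ refl = 0 , ℕ.z≤n , refl
    ... | _ | inj₂ refl = r , ℕP.≤-refl , flip (+ r)
      where
      flip : ∀ r → ℤ.- (-[1+ 0 ] ℤ.* r) ≡ r
      flip = ℤSolver.solve-∀

    e*r<m : ∀ {r} → r ℕ.< m → e ℕ.* r ℕ.< m
    e*r<m {r} r<m = ℕP.≤-<-trans (ℕP.≤-trans (ℕP.*-monoˡ-≤ r e≤1) (ℕP.≤-reflexive (ℕP.*-identityˡ r))) r<m

  encode-βℤ≥0 : ∀ T c → GoodCode m T c → ∀ k → + 0 ℤ.≤ βℤ T (encode c) k
  encode-βℤ≥0 T (q , r , y) (r<m , y≥0 , S≤T) zero = subst (+ 0 ℤ.≤_) (sym (βℤ-encode₀ T q r y))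
    (ℤP.+-mono-≤ (0≤*ℤ {+ m} (ℤ.+≤+ ℕ.z≤n) (ℤP.i≤j⇒0≤j-i S≤T)) (0≤*ℤ {+ e} {+ r} (ℤ.+≤+ ℕ.z≤n) (ℤ.+≤+ ℕ.z≤n)))
  encode-βℤ≥0 T (q , r , y) _    (suc zero) = ℤ.+≤+ ℕ.z≤n
  encode-βℤ≥0 T (q , r , y) (r<m , y≥0 , S≤T) (suc (suc j)) with negated-weight j r
  ... | ρ , _ , -wr≡ρ = subst (+ 0 ℤ.≤_) (sym (trans (β⁺ℤ-encode q r y j) (cong (λ s → + m ℤ.* Vec.lookup y j ℤ.+ s) -wr≡ρ)))
    (ℤP.+-mono-≤ (0≤*ℤ {+ m} (ℤ.+≤+ ℕ.z≤n) (y≥0 j)) (ℤ.+≤+ ℕ.z≤n))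

  decode-βℤ≥0 : ∀ T x → (∀ k → + 0 ℤ.≤ βℤ T x k) → GoodCode m T (decode x) × encode (decode x) ≡ x
  decode-βℤ≥0 T (-[1+ _ ] ∷ xs) βℤ≥0 = contradiction (βℤ≥0 (suc zero)) λ ()
  decode-βℤ≥0 T (+ x₀ ∷ xs)     βℤ≥0 = (r<m , y≥0 , S≤T) , encode-decode
    where
    q = x₀ ℕ./ m
    r = x₀ ℕ.% m
    y = Vec.tabulate (λ j → Vec.lookup xs j ℤ.- + q ℤ.* w j)
    r<m = DivMod.m%n<n x₀ m
    encode-decode : encode (q , r , y) ≡ + x₀ ∷ xs
    encode-decode = cong₂ _∷_ (cong +_ (sym (DivMod.m≡m%n+[m/n]*n x₀ m))) (begin
      Vec.tabulate (λ j → Vec.lookup y j ℤ.+ + q ℤ.* w j)                   ≡⟨ VecP.tabulate-cong (λ j → cong (ℤ._+ + q ℤ.* w j) (VecP.lookup∘tabulate _ j)) ⟩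
      Vec.tabulate (λ j → Vec.lookup xs j ℤ.- + q ℤ.* w j ℤ.+ + q ℤ.* w j)  ≡⟨ VecP.tabulate-cong (λ j → restore (Vec.lookup xs j) (+ q ℤ.* w j)) ⟩
      Vec.tabulate (Vec.lookup xs)                                          ≡⟨ VecP.tabulate∘lookup xs ⟩
      xs                                                                    ∎)
      where
      restore : ∀ a b → a ℤ.- b ℤ.+ b ≡ a
      restore = ℤSolver.solve-∀
    β≥0 : ∀ k → + 0 ℤ.≤ βℤ T (encode (q , r , y)) k
    β≥0 k = subst (λ x → + 0 ℤ.≤ βℤ T x k) (sym encode-decode) (βℤ≥0 k)
    y≥0 : ∀ j → + 0 ℤ.≤ Vec.lookup y j
    y≥0 j with negated-weight j r
    ... | ρ , ρ≤r , -wr≡ρ = nonneg-of-remainder m (Vec.lookup y j) ρ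
      (subst (+ 0 ℤ.≤_) (trans (β⁺ℤ-encode q r y j) (cong (λ s → + m ℤ.* Vec.lookup y j ℤ.+ s) -wr≡ρ)) (β≥0 (suc (suc j))))
      (ℕP.≤-<-trans ρ≤r r<m)
    S≤T : ℤΣ.sum (Vec.lookup y) ℤ.+ + (q ℕ.+ r) ℤ.≤ + T
    S≤T = ℤP.0≤i-j⇒j≤i (nonneg-of-remainder m slack (e ℕ.* r)
      (subst (+ 0 ℤ.≤_) (trans (βℤ-encode₀ T q r y) (cong (λ s → + m ℤ.* slack ℤ.+ s) (sym (ℤP.pos-* e r)))) (β≥0 zero))
      (e*r<m r<m))
      where
      slack = + T ℤ.- (ℤΣ.sum (Vec.lookup y) ℤ.+ + (q ℕ.+ r))

  decode-encode : ∀ c → proj₁ (proj₂ c) ℕ.< m → decode (encode c) ≡ c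
  decode-encode (q , r , y) r<m = cong₂ _,_ quotient (cong₂ _,_ remainder (shifted-back (x₀ ℕ./ m) quotient))
    where
    x₀ = r ℕ.+ q ℕ.* m
    remainder : x₀ ℕ.% m ≡ r
    remainder = trans (DivMod.[m+kn]%n≡m%n r q m) (DivMod.m<n⇒m%n≡m r<m)
    quotient : x₀ ℕ./ m ≡ q
    quotient = ℕP.*-cancelʳ-≡ (x₀ ℕ./ m) q m (ℕP.+-cancelˡ-≡ r _ _
      (trans (cong (ℕ._+ x₀ ℕ./ m ℕ.* m) (sym remainder)) (sym (DivMod.m≡m%n+[m/n]*n x₀ m))))
    shifted-back : ∀ q′ → q′ ≡ q → Vec.tabulate (λ j → Vec.lookup (Vec.tabulate (λ j → Vec.lookup y j ℤ.+ + q ℤ.* w j)) j ℤ.- + q′ ℤ.* w j) ≡ y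
    shifted-back q′ refl = begin
      Vec.tabulate (λ j → Vec.lookup (Vec.tabulate (λ j → Vec.lookup y j ℤ.+ + q ℤ.* w j)) j ℤ.- + q ℤ.* w j)
        ≡⟨ VecP.tabulate-cong (λ j → cong (ℤ._- + q ℤ.* w j) (VecP.lookup∘tabulate _ j)) ⟩
      Vec.tabulate (λ j → Vec.lookup y j ℤ.+ + q ℤ.* w j ℤ.- + q ℤ.* w j)
        ≡⟨ VecP.tabulate-cong (λ j → cancel (Vec.lookup y j) (+ q ℤ.* w j)) ⟩
      Vec.tabulate (Vec.lookup y) ≡⟨ VecP.tabulate∘lookup y ⟩
      y ∎
      where
      cancel : ∀ a b → a ℤ.+ b ℤ.- b ≡ a
      cancel = ℤSolver.solve-∀

  encode-bounded : ∀ T c → GoodCode m T c → ∀ j → ℤ.∣ Vec.lookup (encode c) j ∣ ℕ.≤ T ℕ.* m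
  encode-bounded T (q , r , y) good@(_ , y≥0 , S≤T) = bound
    where
    q+r≤T = code-q+r≤T n {y = y} good
    ∣w∣≤1 : ∀ j → ℤ.∣ w j ∣ ℕ.≤ 1
    ∣w∣≤1 j with w j | negPrefix-values a j
    ... | _ | inj₁ refl = ℕ.z≤n
    ... | _ | inj₂ refl = ℕP.≤-refl
    ∣yⱼ∣+q≤T : ∀ j → ℤ.∣ Vec.lookup y j ∣ ℕ.+ q ℕ.≤ T
    ∣yⱼ∣+q≤T j = ℤP.drop‿+≤+ (subst (ℤ._≤ + T) (sym (trans (ℤP.pos-+ _ q) (cong (ℤ._+ + q) (ℤP.0≤i⇒+∣i∣≡i (y≥0 j)))))
                   (ℤP.≤-trans (ℤP.+-mono-≤ (sumℤ-term n y≥0 j) (ℤ.+≤+ (ℕP.m≤m+n q r))) S≤T))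
    ∣qwⱼ∣≤q : ∀ j → ℤ.∣ + q ℤ.* w j ∣ ℕ.≤ q
    ∣qwⱼ∣≤q j = subst (ℕ._≤ q) (sym (ℤP.∣i*j∣≡∣i∣*∣j∣ (+ q) (w j)))
                  (ℕP.≤-trans (ℕP.*-monoʳ-≤ q (∣w∣≤1 j)) (ℕP.≤-reflexive (ℕP.*-identityʳ q)))
    bound : ∀ j → ℤ.∣ Vec.lookup (encode (q , r , y)) j ∣ ℕ.≤ T ℕ.* m
    bound zero = ℕP.≤-trans (ℕP.+-monoˡ-≤ (q ℕ.* m) (ℕP.m≤m*n r m))
                   (subst (ℕ._≤ T ℕ.* m) (ℕP.*-distribʳ-+ m r q) (ℕP.*-monoˡ-≤ m (subst (ℕ._≤ T) (ℕP.+-comm q r) q+r≤T)))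
    bound (suc j) = subst (λ z → ℤ.∣ z ∣ ℕ.≤ T ℕ.* m) (sym (VecP.lookup∘tabulate _ j))
      (ℕP.≤-trans (ℤP.∣i+j∣≤∣i∣+∣j∣ (Vec.lookup y j) (+ q ℤ.* w j))
        (ℕP.≤-trans (ℕP.+-monoʳ-≤ ℤ.∣ Vec.lookup y j ∣ (∣qwⱼ∣≤q j)) (ℕP.≤-trans (∣yⱼ∣+q≤T j) (ℕP.m≤m*n T m))))

  latticePoint⇒code : ∀ T x → LatticePts V T x → GoodCode m T (decode x) × encode (decode x) ≡ x
  latticePoint⇒code T x x∈ = decode-βℤ≥0 T x (latticePoint⇒βℤ≥0 T x x∈)

  code⇒latticePoint : ∀ T′ c → GoodCode m (suc T′) c → LatticePts V (suc T′) (encode c)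
  code⇒latticePoint T′ c good = βℤ≥0⇒latticePoint T′ (encode c) (encode-βℤ≥0 (suc T′) c good)

  latticeCount : ∀ T′ → Σ ℕ (HasCount (LatticePts V (suc T′)))
  latticeCount T′ = map₂ (HasCount-cong (βℤ≥0⇒latticePoint T′) (latticePoint⇒βℤ≥0 (suc T′)))
                         (countable (λ x → FinP.all? (λ k → + 0 ℤP.≤? βℤ (suc T′) x k)) (suc T′ ℕ.* m) bounded)
    where
    bounded : ∀ x → (∀ k → + 0 ℤ.≤ βℤ (suc T′) x k) → ∀ j → ℤ.∣ Vec.lookup x j ∣ ℕ.≤ suc T′ ℕ.* m
    bounded x βℤ≥0 j = subst (λ z → ℤ.∣ Vec.lookup z j ∣ ℕ.≤ suc T′ ℕ.* m) (proj₂ decoded) (encode-bounded (suc T′) (decode x) (proj₁ decoded) j)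
      where decoded = decode-βℤ≥0 (suc T′) x βℤ≥0

  lowerBound : Fin (suc (suc n)) → ℤ
  lowerBound zero          = + 1
  lowerBound (suc zero)    = + 1
  lowerBound (suc (suc j)) = + m ℤ.+ (+ m ℤ.- + 1) ℤ.* w j

  threshold : ℕ
  threshold = m ℕ.* (n ∸ a) ℕ.+ a ℕ.+ 2

  sum-lowerBound : ℤΣ.sum lowerBound ≡ + threshold
  sum-lowerBound = begin
    + 1 ℤ.+ (+ 1 ℤ.+ ℤΣ.sum (λ j → + m ℤ.+ (+ m ℤ.- + 1) ℤ.* w j))
      ≡⟨ cong (λ s → + 1 ℤ.+ (+ 1 ℤ.+ s)) (trans (ℤΣ.∑-distrib-+ (λ _ → + m) (λ j → (+ m ℤ.- + 1) ℤ.* w j))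
                                                 (cong₂ ℤ._+_ (sumℤ-const n (+ m)) (sym (ℤΣ.*-distribˡ-sum (+ m ℤ.- + 1) w)))) ⟩
    + 1 ℤ.+ (+ 1 ℤ.+ (+ n ℤ.* + m ℤ.+ (+ m ℤ.- + 1) ℤ.* ℤΣ.sum w))
      ≡⟨ cong₂ (λ k s → + 1 ℤ.+ (+ 1 ℤ.+ (k ℤ.* + m ℤ.+ (+ m ℤ.- + 1) ℤ.* s))) n≡ (sum-negPrefix a n a≤n) ⟩
    + 1 ℤ.+ (+ 1 ℤ.+ ((+ (n ∸ a) ℤ.+ + a) ℤ.* + m ℤ.+ (+ m ℤ.- + 1) ℤ.* ℤ.- + a))
      ≡⟨ collect (+ m) (+ (n ∸ a)) (+ a) ⟩
    + m ℤ.* + (n ∸ a) ℤ.+ + a ℤ.+ + 2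
      ≡⟨ cong (λ s → s ℤ.+ + a ℤ.+ + 2) (ℤP.pos-* m (n ∸ a)) ⟨
    + (m ℕ.* (n ∸ a)) ℤ.+ + a ℤ.+ + 2
      ≡⟨ trans (cong (ℤ._+ + 2) (ℤP.pos-+ (m ℕ.* (n ∸ a)) a)) (ℤP.pos-+ (m ℕ.* (n ∸ a) ℕ.+ a) 2) ⟨
    + threshold ∎
    where
    n≡ : + n ≡ + (n ∸ a) ℤ.+ + a
    n≡ = trans (cong +_ (sym (ℕP.m∸n+n≡m a≤n))) (ℤP.pos-+ (n ∸ a) a)
    collect : ∀ M K A → + 1 ℤ.+ (+ 1 ℤ.+ ((K ℤ.+ A) ℤ.* M ℤ.+ (M ℤ.- + 1) ℤ.* ℤ.- A)) ≡ M ℤ.* K ℤ.+ A ℤ.+ + 2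
    collect = ℤSolver.solve-∀

  private
    lowerBound-w₀ : ∀ m → m ℤ.+ (m ℤ.- + 1) ℤ.* + 0 ≡ m
    lowerBound-w₀ = ℤSolver.solve-∀

    lowerBound-w₁ : ∀ m → m ℤ.+ (m ℤ.- + 1) ℤ.* -[1+ 0 ] ≡ + 1
    lowerBound-w₁ = ℤSolver.solve-∀

  lowerBound>0 : ∀ k → + 0 ℤ.< lowerBound k
  lowerBound>0 zero          = ℤ.+<+ (ℕ.s≤s ℕ.z≤n)
  lowerBound>0 (suc zero)    = ℤ.+<+ (ℕ.s≤s ℕ.z≤n)
  lowerBound>0 (suc (suc j)) with w j | negPrefix-values a j
  ... | _ | inj₁ refl = subst (+ 0 ℤ.<_) (sym (lowerBound-w₀ (+ m))) (ℤ.+<+ (ℕ.s≤s ℕ.z≤n))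
  ... | _ | inj₂ refl = subst (+ 0 ℤ.<_) (sym (lowerBound-w₁ (+ m))) (ℤ.+<+ (ℕ.s≤s ℕ.z≤n))

  βℤ>0⇒lowerBound≤βℤ : ∀ T x → (∀ k → + 0 ℤ.< βℤ T x k) → ∀ k → lowerBound k ℤ.≤ βℤ T x k
  βℤ>0⇒lowerBound≤βℤ T x βℤ>0 zero       = ℤP.i<j⇒suc[i]≤j (βℤ>0 zero)
  βℤ>0⇒lowerBound≤βℤ T x βℤ>0 (suc zero) = ℤP.i<j⇒suc[i]≤j (βℤ>0 (suc zero))
  βℤ>0⇒lowerBound≤βℤ T x βℤ>0 (suc (suc j)) with negPrefix-values a j
  ... | inj₁ w≡0 = subst₂ ℤ._≤_ (sym (trans (cong (λ z → + m ℤ.+ (+ m ℤ.- + 1) ℤ.* z) w≡0) (lowerBound-w₀ (+ m)))) (sym β≡mxⱼ)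
                     (subst (ℤ._≤ + m ℤ.* xⱼ) (ℤP.*-identityʳ (+ m)) (ℤP.*-monoˡ-≤-nonNeg (+ m) (ℤP.i<j⇒suc[i]≤j xⱼ>0)))
    where
    xⱼ = Vec.lookup x (suc j)
    x₀ = Vec.lookup x zero
    drop-w : ∀ m x x₀ → m ℤ.* x ℤ.- + 0 ℤ.* x₀ ≡ m ℤ.* x
    drop-w = ℤSolver.solve-∀
    β≡mxⱼ : βℤ T x (suc (suc j)) ≡ + m ℤ.* xⱼ
    β≡mxⱼ = trans (cong (λ z → + m ℤ.* xⱼ ℤ.- z ℤ.* x₀) w≡0) (drop-w (+ m) xⱼ x₀)
    xⱼ>0 : + 0 ℤ.< xⱼ
    xⱼ>0 = ℤP.*-cancelˡ-<-nonNeg (+ m) (subst₂ ℤ._<_ (sym (ℤP.*-zeroʳ (+ m))) β≡mxⱼ (βℤ>0 (suc (suc j))))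
  ... | inj₂ w≡-1 = subst (ℤ._≤ βℤ T x (suc (suc j))) (sym (trans (cong (λ z → + m ℤ.+ (+ m ℤ.- + 1) ℤ.* z) w≡-1) (lowerBound-w₁ (+ m))))
                      (ℤP.i<j⇒suc[i]≤j (βℤ>0 (suc (suc j))))

  innermost : Point (suc n)
  innermost = + 1 ∷ Vec.tabulate (λ j → + 1 ℤ.+ w j)

  β⁺ℤ-innermost : ∀ k → β⁺ℤ innermost k ≡ lowerBound (suc k)
  β⁺ℤ-innermost zero    = refl
  β⁺ℤ-innermost (suc j) = trans (cong (λ z → + m ℤ.* z ℤ.- w j ℤ.* + 1) (VecP.lookup∘tabulate _ j)) (shear (+ m) (w j))
    where
    shear : ∀ m w → m ℤ.* (+ 1 ℤ.+ w) ℤ.- w ℤ.* + 1 ≡ m ℤ.+ (m ℤ.- + 1) ℤ.* w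
    shear = ℤSolver.solve-∀

  βℤ-innermost : ∀ T → m ℕ.* T ≡ threshold → ∀ k → βℤ T innermost k ≡ lowerBound k
  βℤ-innermost T mT≡ zero = begin
    + m ℤ.* + T ℤ.- ℤΣ.sum (β⁺ℤ innermost)  ≡⟨ cong₂ ℤ._-_ (trans (sym (ℤP.pos-* m T)) (trans (cong +_ mT≡) (sym sum-lowerBound)))
                                                                          (ℤΣ.sum-cong-≗ β⁺ℤ-innermost) ⟩
    (+ 1 ℤ.+ ℤΣ.sum (λ k → lowerBound (suc k))) ℤ.- ℤΣ.sum (λ k → lowerBound (suc k))  ≡⟨ cancel (+ 1) (ℤΣ.sum (λ k → lowerBound (suc k))) ⟩
    + 1                                                         ∎
    where
    cancel : ∀ a b → a ℤ.+ b ℤ.- b ≡ a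
    cancel = ℤSolver.solve-∀
  βℤ-innermost T mT≡ (suc k) = β⁺ℤ-innermost k

  interiorCount-below : ∀ T → m ℕ.* T ℕ.< threshold → HasCount (InteriorLatticePts V T) 0
  interiorCount-below T mT<threshold = HasCount-∅ λ x x∈ → ℤP.<⇒≱ (ℤ.+<+ mT<threshold) (threshold≤mT x x∈)
    where
    threshold≤mT : ∀ x → InteriorLatticePts V T x → + threshold ℤ.≤ + (m ℕ.* T)
    threshold≤mT x x∈ = subst₂ ℤ._≤_ sum-lowerBound (trans (sum-βℤ T x) (sym (ℤP.pos-* m T)))
                     (sumℤ-mono (suc (suc n)) (βℤ>0⇒lowerBound≤βℤ T x (interiorPoint⇒βℤ>0 T x x∈)))

  interiorCount-at : ∀ T′ → m ℕ.* suc T′ ≡ threshold → HasCount (InteriorLatticePts V (suc T′)) 1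
  interiorCount-at T′ mT≡ = HasCount-singleton innermost innermost-interior unique
    where
    innermost-interior = βℤ>0⇒interiorPoint T′ innermost (λ k →
      subst (+ 0 ℤ.<_) (sym (βℤ-innermost (suc T′) mT≡ k)) (lowerBound>0 k))
    unique : ∀ x → InteriorLatticePts V (suc T′) x → x ≡ innermost
    unique x x∈ = βℤ-injective (suc T′) λ k → sym (trans (βℤ-innermost (suc T′) mT≡ k) (sumℤ-tight (suc (suc n)) lowerBound≤β ∑β≤∑L k))
      where
      lowerBound≤β = βℤ>0⇒lowerBound≤βℤ (suc T′) x (interiorPoint⇒βℤ>0 (suc T′) x x∈)
      ∑β≤∑L : ℤΣ.sum (βℤ (suc T′) x) ℤ.≤ ℤΣ.sum lowerBound
      ∑β≤∑L = ℤP.≤-reflexive (trans (sum-βℤ (suc T′) x) (trans (sym (ℤP.pos-* m (suc T′))) (trans (cong +_ mT≡) (sym sum-lowerBound))))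

module Comparison (n aQ eQ aP eP : ℕ) (aQ≤n : aQ ℕ.≤ n) (eQ≤1 : eQ ℕ.≤ 1) (aP≤n : aP ℕ.≤ n) (eP≤1 : eP ℕ.≤ 1)
                  (mQ<mP : eQ ℕ.+ aQ ℕ.< eP ℕ.+ aP) where

  module Q = Family n aQ eQ aQ≤n eQ≤1
  module P = Family n aP eP aP≤n eP≤1

  extraCode : Code n
  extraCode = 0 , Q.m , Vec.replicate n (+ 0)

  Q⇒P : ∀ {T} (c : Code n) → GoodCode Q.m T c → GoodCode P.m T c
  Q⇒P c (r<mQ , y≥0 , S≤T) = ℕP.<-trans r<mQ (ℕ.s≤s mQ<mP) , y≥0 , S≤T

  P⇒Q : ∀ T (c : Code n) → T ℕ.≤ Q.m → GoodCode P.m T c → GoodCode Q.m T c ⊎ (T ≡ Q.m × c ≡ extraCode)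
  P⇒Q T (q , r , y) T≤mQ good@(_ , y≥0 , S≤T) with r ℕP.<? Q.m
  ... | yes r<mQ = inj₁ (r<mQ , y≥0 , S≤T)
  ... | no r≮mQ  = inj₂ (T≡mQ , cong₂ _,_ q≡0 (cong₂ _,_ r≡mQ y≡0))
    where
    q+r≤T = code-q+r≤T n {y = y} good
    r≤T = ℕP.≤-trans (ℕP.m≤n+m r q) q+r≤T
    mQ≤r = ℕP.≮⇒≥ r≮mQ
    r≡mQ : r ≡ Q.m
    r≡mQ = ℕP.≤-antisym (ℕP.≤-trans r≤T T≤mQ) mQ≤r
    T≡mQ : T ≡ Q.m
    T≡mQ = ℕP.≤-antisym T≤mQ (ℕP.≤-trans mQ≤r r≤T)
    q+r≡T : q ℕ.+ r ≡ T
    q+r≡T = ℕP.≤-antisym q+r≤T (ℕP.≤-trans (ℕP.≤-reflexive (trans T≡mQ (sym r≡mQ))) (ℕP.m≤n+m r q))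
    q≡0 : q ≡ 0
    q≡0 = ℕP.n≤0⇒n≡0 (ℕP.+-cancelʳ-≤ r q 0 (ℕP.≤-reflexive (trans q+r≡T (trans T≡mQ (sym r≡mQ)))))
    S≤0 : ℤΣ.sum (Vec.lookup y) ℤ.≤ + 0
    S≤0 = +-cancelˡ-≤ (+ T) (subst₂ ℤ._≤_ (trans (cong (λ k → ℤΣ.sum (Vec.lookup y) ℤ.+ + k) q+r≡T) (ℤP.+-comm (ℤΣ.sum (Vec.lookup y)) (+ T)))
                                        (sym (ℤP.+-identityʳ (+ T))) S≤T)
    y≡0 : y ≡ Vec.replicate n (+ 0)
    y≡0 = lookup-ext λ j → trans (sym (sumℤ-tight n {f = λ _ → + 0} y≥0 (subst (ℤΣ.sum (Vec.lookup y) ℤ.≤_) (sym (ℤΣ.sum-replicate-zero n)) S≤0) j))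
                                 (sym (VecP.lookup-replicate j (+ 0)))

  recode : Point (suc n) → Point (suc n)
  recode x = P.encode (Q.decode x)

  extraPoint : Point (suc n)
  extraPoint = P.encode extraCode

  private
    P-decode-recode : ∀ T x → LatticePts Q.V T x → P.decode (recode x) ≡ Q.decode x
    P-decode-recode T x x∈ = P.decode-encode (Q.decode x) (proj₁ (Q⇒P (Q.decode x) (proj₁ (Q.latticePoint⇒code T x x∈))))

  recode-latticePoint : ∀ T′ x → LatticePts Q.V (suc T′) x → LatticePts P.V (suc T′) (recode x)
  recode-latticePoint T′ x x∈ = P.code⇒latticePoint T′ (Q.decode x) (Q⇒P (Q.decode x) (proj₁ (Q.latticePoint⇒code (suc T′) x x∈)))

  recode-injective : ∀ T x x′ → LatticePts Q.V T x → LatticePts Q.V T x′ → recode x ≡ recode x′ → x ≡ x′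
  recode-injective T x x′ x∈ x′∈ recode-x≡x′ = begin
    x                       ≡⟨ proj₂ (Q.latticePoint⇒code T x x∈) ⟨
    Q.encode (Q.decode x)   ≡⟨ cong Q.encode (trans (sym (P-decode-recode T x x∈)) (trans (cong P.decode recode-x≡x′) (P-decode-recode T x′ x′∈))) ⟩
    Q.encode (Q.decode x′)  ≡⟨ proj₂ (Q.latticePoint⇒code T x′ x′∈) ⟩
    x′                      ∎

  extraPoint-latticePoint : LatticePts P.V Q.m extraPoint
  extraPoint-latticePoint = P.code⇒latticePoint (eQ ℕ.+ aQ) extraCode
    (ℕ.s≤s mQ<mP , (λ j → ℤP.≤-reflexive (sym (VecP.lookup-replicate j (+ 0)))) , ℤP.≤-reflexive (cong (ℤ._+ + Q.m) sum-zeros))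
    where
    sum-zeros : ℤΣ.sum (Vec.lookup (Vec.replicate n (+ 0))) ≡ + 0
    sum-zeros = trans (ℤΣ.sum-cong-≗ {n} (λ j → VecP.lookup-replicate j (+ 0))) (ℤΣ.sum-replicate-zero n)

  extraPoint∉image : ∀ x → LatticePts Q.V Q.m x → recode x ≢ extraPoint
  extraPoint∉image x x∈ recode-x≡extra = ℕP.<-irrefl (cong (λ c → proj₁ (proj₂ c)) decode≡) (proj₁ (proj₁ (Q.latticePoint⇒code Q.m x x∈)))
    where
    decode≡ : Q.decode x ≡ extraCode
    decode≡ = trans (sym (P-decode-recode Q.m x x∈)) (trans (cong P.decode recode-x≡extra) (P.decode-encode extraCode (ℕ.s≤s mQ<mP)))

  P-latticePoint-recoded : ∀ T′ x′ → suc T′ ℕ.≤ Q.m → LatticePts P.V (suc T′) x′ →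
                           Image recode (LatticePts Q.V (suc T′)) x′ ⊎ (suc T′ ≡ Q.m × x′ ≡ extraPoint)
  P-latticePoint-recoded T′ x′ T≤mQ x′∈ = [ recoded , extra ]′ (P⇒Q (suc T′) (P.decode x′) T≤mQ (proj₁ decoded))
    where
    decoded = P.latticePoint⇒code (suc T′) x′ x′∈
    recoded : GoodCode Q.m (suc T′) (P.decode x′) → Image recode (LatticePts Q.V (suc T′)) x′ ⊎ (suc T′ ≡ Q.m × x′ ≡ extraPoint)
    recoded good = inj₁ (Q.encode (P.decode x′) , Q.code⇒latticePoint T′ (P.decode x′) good
                        , trans (cong P.encode (Q.decode-encode (P.decode x′) (proj₁ good))) (proj₂ decoded))
    extra : suc T′ ≡ Q.m × P.decode x′ ≡ extraCode → Image recode (LatticePts Q.V (suc T′)) x′ ⊎ (suc T′ ≡ Q.m × x′ ≡ extraPoint)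
    extra (T≡mQ , decode≡extra) = inj₂ (T≡mQ , trans (sym (proj₂ decoded)) (cong P.encode decode≡extra))

  sameCount : ∀ T′ → suc T′ ℕ.< Q.m → SameCount (LatticePts P.V (suc T′)) (LatticePts Q.V (suc T′))
  sameCount T′ T<mQ = proj₁ countQ , HasCount-cong image⊆P P⊆image (HasCount-image recode (recode-injective (suc T′)) (proj₂ countQ)) , proj₂ countQ
    where
    countQ = Q.latticeCount T′
    image⊆P : ∀ x′ → Image recode (LatticePts Q.V (suc T′)) x′ → LatticePts P.V (suc T′) x′
    image⊆P _ (x , x∈ , refl) = recode-latticePoint T′ x x∈
    P⊆image : ∀ x′ → LatticePts P.V (suc T′) x′ → Image recode (LatticePts Q.V (suc T′)) x′
    P⊆image x′ x′∈ = [ id , (λ (T≡mQ , _) → contradiction T≡mQ (ℕP.<⇒≢ T<mQ)) ]′ (P-latticePoint-recoded T′ x′ (ℕP.<⇒≤ T<mQ) x′∈)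

  countDiffers : DiffCount (LatticePts P.V Q.m) (LatticePts Q.V Q.m)
  countDiffers = suc (proj₁ countQ) , proj₁ countQ , HasCount-cong image+extra⊆P P⊆image+extra countP , proj₂ countQ , ℕP.1+n≢n
    where
    countQ = Q.latticeCount (eQ ℕ.+ aQ)
    countP = HasCount-insert extraPoint (λ (x , x∈ , recode-x≡extra) → extraPoint∉image x x∈ recode-x≡extra)
                             (HasCount-image recode (recode-injective Q.m) (proj₂ countQ))
    image+extra⊆P : ∀ x′ → x′ ≡ extraPoint ⊎ Image recode (LatticePts Q.V Q.m) x′ → LatticePts P.V Q.m x′
    image+extra⊆P _ (inj₁ refl)            = extraPoint-latticePoint
    image+extra⊆P _ (inj₂ (x , x∈ , refl)) = recode-latticePoint (eQ ℕ.+ aQ) x x∈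
    P⊆image+extra : ∀ x′ → LatticePts P.V Q.m x′ → x′ ≡ extraPoint ⊎ Image recode (LatticePts Q.V Q.m) x′
    P⊆image+extra x′ x′∈ = [ inj₂ , (λ (_ , x′≡extra) → inj₁ x′≡extra) ]′ (P-latticePoint-recoded (eQ ℕ.+ aQ) x′ ℕP.≤-refl x′∈)

module Construction (n k ℓ : ℕ) (k+ℓ≤n : k ℕ.+ ℓ ℕ.≤ n) where

  private
    ℓ≤n : ℓ ℕ.≤ n
    ℓ≤n = ℕP.m+n≤o⇒n≤o k k+ℓ≤n

    k≤n : k ℕ.≤ n
    k≤n = ℕP.m+n≤o⇒m≤o k k+ℓ≤n

    k≤n∸ℓ : k ℕ.≤ n ∸ ℓ
    k≤n∸ℓ = ℕP.m+n≤o⇒m≤o∸n k k+ℓ≤n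

    ℓ≤n∸k : ℓ ℕ.≤ n ∸ k
    ℓ≤n∸k = ℕP.m+n≤o⇒m≤o∸n ℓ (subst (ℕ._≤ n) (ℕP.+-comm k ℓ) k+ℓ≤n)

  open Comparison n k 0 (n ∸ ℓ) 1 k≤n ℕ.z≤n (ℕP.m∸n≤m n ℓ) ℕP.≤-refl (ℕ.s≤s k≤n∸ℓ) public

  private
    P-threshold : P.threshold ≡ P.m ℕ.* ℓ ℕ.+ P.m
    P-threshold = begin
      P.m ℕ.* (n ∸ (n ∸ ℓ)) ℕ.+ (n ∸ ℓ) ℕ.+ 2  ≡⟨ cong (λ l → P.m ℕ.* l ℕ.+ (n ∸ ℓ) ℕ.+ 2) (ℕP.m∸[m∸n]≡n ℓ≤n) ⟩
      P.m ℕ.* ℓ ℕ.+ (n ∸ ℓ) ℕ.+ 2              ≡⟨ ℕP.+-assoc (P.m ℕ.* ℓ) (n ∸ ℓ) 2 ⟩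
      P.m ℕ.* ℓ ℕ.+ ((n ∸ ℓ) ℕ.+ 2)            ≡⟨ cong (P.m ℕ.* ℓ ℕ.+_) (ℕP.+-comm (n ∸ ℓ) 2) ⟩
      P.m ℕ.* ℓ ℕ.+ P.m                        ∎

    Q-threshold : Q.m ℕ.* suc (n ∸ k) ℕ.< Q.threshold
    Q-threshold = subst (ℕ._< Q.threshold) (sym (unfold k (n ∸ k))) (ℕP.+-monoʳ-< (Q.m ℕ.* (n ∸ k) ℕ.+ k) (ℕP.n<1+n 1))
      where
      unfold : ∀ k N → (1 ℕ.+ k) ℕ.* (1 ℕ.+ N) ≡ (1 ℕ.+ k) ℕ.* N ℕ.+ k ℕ.+ 1
      unfold = ℕSolver.solve-∀

  P-interior-empty : ∀ t → t ℕ.≤ ℓ → HasCount (InteriorLatticePts P.V t) 0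
  P-interior-empty t t≤ℓ = P.interiorCount-below t
    (subst (P.m ℕ.* t ℕ.<_) (sym P-threshold) (ℕP.≤-<-trans (ℕP.*-monoʳ-≤ P.m t≤ℓ) (ℕP.m<m+n (P.m ℕ.* ℓ) (ℕ.s≤s ℕ.z≤n))))

  P-interior-single : HasCount (InteriorLatticePts P.V (suc ℓ)) 1
  P-interior-single = P.interiorCount-at ℓ (trans (ℕP.*-suc P.m ℓ) (trans (ℕP.+-comm P.m (P.m ℕ.* ℓ)) (sym P-threshold)))

  Q-interior-empty : ∀ t → t ℕ.≤ suc ℓ → HasCount (InteriorLatticePts Q.V t) 0
  Q-interior-empty t t≤1+ℓ = Q.interiorCount-below t (ℕP.≤-<-trans (ℕP.*-monoʳ-≤ Q.m (ℕP.≤-trans t≤1+ℓ (ℕ.s≤s ℓ≤n∸k))) Q-threshold)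

open import Data.Nat using (_+_; _∸_; _≤_)

theorem0p2 : (d : ℕ) → 1 ≤ d → (k ℓ : ℕ) → k + ℓ ≤ d ∸ 1 →
    Σ (IntegralPolytope d) λ P → Σ (IntegralPolytope d) λ Q →
        FullDim P × FullDim Q
      × (∀ t → 1 ≤ t → t ≤ k → SameCount (LatticePts P t) (LatticePts Q t))
      × (∀ t → 1 ≤ t → t ≤ ℓ → SameCount (InteriorLatticePts P t) (InteriorLatticePts Q t))
      × DiffCount (LatticePts P (suc k)) (LatticePts Q (suc k))
      × DiffCount (InteriorLatticePts P (suc ℓ)) (InteriorLatticePts Q (suc ℓ))
theorem0p2 zero    ()
theorem0p2 (suc n) _ k ℓ k+ℓ≤n =
    P.V , Q.V , P.fullDim , Q.fullDim
  , (λ { (suc t′) _ t≤k → sameCount t′ (ℕ.s≤s t≤k) })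
  , (λ t _ t≤ℓ → 0 , P-interior-empty t t≤ℓ , Q-interior-empty t (ℕP.m≤n⇒m≤1+n t≤ℓ))
  , countDiffers
  , (1 , 0 , P-interior-single , Q-interior-empty (suc ℓ) ℕP.≤-refl , λ ())
  where open Construction n k ℓ k+ℓ≤n
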